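{- Let $I,J,K$ be pairwise disjoint countable index sets, let $r_i\in\mathbb{Z}_+$ for all $i\in I\cup J\cup K$ and $s_i\in\mathbb{Z}_{\geq0}$ for all $i\in I\cup J$, and put $\mathcal{U}=\{(r_i,s_i)\mid i\in I\}$, $\mathcal{V}=\{(r_i,s_i)\mid i\in J\}$, $\mathcal{W}=\{(r_i,-1)\mid i\in K\}$. Let $f:\mathbb{Z}_+\to\mathbb{C}$, $F(x)=1+\sum_{\ell\geq1}f(\ell)x^\ell$, $V(x,y)=\sum_{i\in J}x^{r_i}y^{s_i}$, and let $p_n$ be as in the context. (A1) If $\mathcal{U}=\{(1,s)\}$ for some $s\in\mathbb{Z}_{\geq0}$, $r_i=1$ for all $i\in J$, and $\mathcal{W}=\{(1,-1)\}$, then for all $n\geq0$ \[p_n=\sum_{i=0}^{\lfloor\frac{n}{s+1}\rfloor}\frac1{n-i+1}\left([x^i]F(x)^{n-i+1}\right)\left([x^{n-(s+1)i}]\left(1+xV(1,x)\right)^{n-i+1}\right).\] (A2) If $\mathcal{U}=\{(r_1,s_1)\}$, $\mathcal{V}=\{(r_2,s_2)\}$ and $\mathcal{W}=\{(w,-1)\}$ (with $r_1,r_2,w\in\mathbb{Z}_+$, $s_1,s_2\in\mathbb{Z}_{\geq0}$), then for all $n\geq0$ \[p_n=\sum_{\substack{(ws_1+r_1)i+(ws_2+r_2)j=n\\i,j\geq0}}\frac{1}{s_1i+(s_2+1)j+1}\left([x^i]F(x)^{s_1i+(s_2+1)j+1}\right)\binom{s_1i+(s_2+1)j+1}{j}.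\]
   Context: For $n\in\mathbb{Z}_{\geq0}$, $\mathcal{P}_n$ denotes the set of lattice paths from $(0,0)$ to $(n,0)$ that never go below the $x$-axis and each of whose steps lies in $\mathcal{U}\cup\mathcal{V}\cup\mathcal{W}$. For $P\in\mathcal{P}_n$, $\mathbf{u}(P)$ is the vector recording, in order, the lengths of the maximal blocks of consecutive steps of $P$ that belong to $\mathcal{U}$, and $p_n=\sum_{P\in\mathcal{P}_n}\prod_{i=1}^{|\mathbf{u}(P)|}f(\mathbf{u}(P)_i)$ (empty product $=1$). $[x^m]G(x)$ denotes the coefficient of $x^m$ in the power series $G$. -}

module Defs where

open import Level using (Level)
open import Data.Bool using (Bool; true; false; if_then_else_; _∧_)
open import Data.Nat using (ℕ; zero; suc; _+_; _*_; _∸_; _≡ᵇ_; _≤ᵇ_; _/_)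
open import Data.Nat.Combinatorics using (_C_)
open import Data.List using (List; []; _∷_; map; concatMap; filterᵇ; upTo; replicate; concat)
open import Algebra.Bundles using (CommutativeRing)

-- vertical displacement of a step: (r , s) with s ≥ 0 is  up s,
-- (r , -1) is  down
data Move : Set where
  up   : ℕ → Move
  down : Move

record Step : Set where
  constructor step
  field
    len  : ℕ
    move : Move
    inU  : Bool
open Step public

-- all words over the alphabet (a list; repeated entries are distinct
-- labels) whose horizontal lengths sum to n.  Steps of length 0 are never
-- used (all steps in the paper have r ≥ 1).  The first argument is fuel.
words : ℕ → List Step → ℕ → List (List Step)
words _          A zero    = [] ∷ []
words zero       A (suc n) = []
words (suc fuel) A (suc n) =
  concatMap (λ a → if len a ≡ᵇ 0 then []
                   else if len a ≤ᵇ suc n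
                        then map (a ∷_) (words fuel A (suc n ∸ len a))
                        else [])
            A

valid : ℕ → List Step → Bool
valid h []       = h ≡ᵇ 0
valid h (a ∷ w) with move a
... | up s = valid (h + s) w
valid zero    (a ∷ w) | down = false
valid (suc h) (a ∷ w) | down = valid h w

paths : List Step → ℕ → List (List Step)
paths A n = filterᵇ (valid 0) (words n A n)

ublocksFrom : ℕ → List Step → List ℕ
ublocksFrom zero    []      = []
ublocksFrom (suc k) []      = suc k ∷ []
ublocksFrom k (a ∷ w) with inU a
... | true  = ublocksFrom (suc k) w
ublocksFrom zero    (a ∷ w) | false = ublocksFrom zero w
ublocksFrom (suc k) (a ∷ w) | false = suc k ∷ ublocksFrom zero w

ublocks : List Step → List ℕ
ublocks = ublocksFrom 0

module _ {c ℓ : Level} (R : CommutativeRing c ℓ) where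
  open CommutativeRing R renaming (_+_ to _+R_; _*_ to _*R_)

  Σl : List Carrier → Carrier
  Σl []       = 0#
  Σl (x ∷ xs) = x +R Σl xs

  Πl : List Carrier → Carrier
  Πl []       = 1#
  Πl (x ∷ xs) = x *R Πl xs

  fromℕ : ℕ → Carrier
  fromℕ zero    = 0#
  fromℕ (suc n) = 1# +R fromℕ n

  -- R is a ℚ-algebra, witnessed by inverses: inv m = 1/(m+1)
  IsInvNat : (ℕ → Carrier) → Set ℓ
  IsInvNat inv = ∀ m → fromℕ (suc m) *R inv m ≈ 1#

  pathSum : (ℕ → Carrier) → List Step → ℕ → Carrier
  pathSum f A n = Σl (map (λ P → Πl (map f (ublocks P))) (paths A n))

  -- formal power series as coefficient sequences; [x^m]G = G m
  PS : Set c
  PS = ℕ → Carrier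

  onePS : PS
  onePS zero    = 1#
  onePS (suc _) = 0#

  _*PS_ : PS → PS → PS
  (a *PS b) k = Σl (map (λ j → a j *R b (k ∸ j)) (upTo (suc k)))

  _^PS_ : PS → ℕ → PS
  a ^PS zero  = onePS
  a ^PS suc m = a *PS (a ^PS m)

  -- F(x) = 1 + Σ_{ℓ≥1} f(ℓ) x^ℓ   (the value f 0 is irrelevant)
  Fser : (ℕ → Carrier) → PS
  Fser f zero    = 1#
  Fser f (suc ℓ) = f (suc ℓ)

  -- 1 + x V(1,x), where cnt t = #{ i ∈ J | s_i = t } (r_i = 1 on J)
  oneXV : (ℕ → ℕ) → PS
  oneXV cnt zero    = 1#
  oneXV cnt (suc t) = fromℕ (cnt t)

-- (A1): 𝒰 = {(1,s)}, 𝒱 = {(1,t) with multiplicity cnt t}, 𝒲 = {(1,-1)}.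
-- For paths of length n only 𝒱-steps with t ≤ n can occur, so the
-- alphabet is truncated there (the set 𝒫_n is unchanged).
alphabetA1 : ℕ → (ℕ → ℕ) → ℕ → List Step
alphabetA1 s cnt n =
  step 1 (up s) true ∷ step 1 down false ∷
  concat (map (λ t → replicate (cnt t) (step 1 (up t) false)) (upTo (suc n)))

alphabetA2 : ℕ → ℕ → ℕ → ℕ → ℕ → List Step
alphabetA2 r₁ s₁ r₂ s₂ w =
  step r₁ (up s₁) true ∷ step r₂ (up s₂) false ∷ step w down false ∷ []

module _ {c ℓ : Level} (R : CommutativeRing c ℓ) where
  open CommutativeRing R renaming (_+_ to _+R_; _*_ to _*R_)

  -- right-hand side of (A1); inv m = 1/(m+1), so inv (n ∸ i) = 1/(n-i+1)
  rhsA1 : (ℕ → Carrier) → (ℕ → Carrier) → ℕ → (ℕ → ℕ) → ℕ → Carrier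
  rhsA1 inv f s cnt n =
    Σl R (map (λ i → inv (n ∸ i)
                     *R ((_^PS_ R (Fser R f) (suc (n ∸ i))) i
                     *R (_^PS_ R (oneXV R cnt) (suc (n ∸ i))) (n ∸ (suc s * i))))
              (upTo (suc (n / suc s))))

  -- right-hand side of (A2): sum over i, j ≥ 0 with
  -- (w s₁ + r₁) i + (w s₂ + r₂) j = n  (necessarily i, j ≤ n)
  rhsA2 : (ℕ → Carrier) → (ℕ → Carrier) → ℕ → ℕ → ℕ → ℕ → ℕ → ℕ → Carrier
  rhsA2 inv f r₁ s₁ r₂ s₂ w n =
    Σl R (concatMap (λ i → concatMap (λ j →
            if (w * s₁ + r₁) * i + (w * s₂ + r₂) * j ≡ᵇ n
            then (inv (s₁ * i + suc s₂ * j)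
                  *R ((_^PS_ R (Fser R f) (s₁ * i + suc s₂ * j + 1)) i
                  *R fromℕ R ((s₁ * i + suc s₂ * j + 1) C j))) ∷ []
            else []) (upTo (suc n))) (upTo (suc n)))

{-# OPTIONS --safe #-}
-- Let u be the unique 𝒰-step and W = (w, -1) the unique down step.  Appending W to a path of
-- length n gives a word that first reaches height -1 with its last step; cutting it after
-- every non-𝒰 step writes it uniquely as a sequence of units uˡ b, and the weight of the path
-- is the product of F(l) over its units (F(0) = 1 accounts for empty blocks).  By the cycle
-- lemma, exactly one cyclic rotation of a sequence of m units of total height change -1 first
-- reaches -1 at its end, so the sum over such first-passage sequences is 1/m times the sum
-- over all sequences of m units of total height change -1.  That sum factorises: the 𝒰-blocks
-- contribute [xⁱ] F(x)ᵐ and the closing steps a count of non-𝒰 words of prescribed height and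
-- length, which is a coefficient of (1 + xV(1,x))ᵐ in (A1) and a binomial coefficient in (A2).
-- Solving the length constraint for m gives the two formulas.
module Submission where

open import Level using (Level)
open import Function using (_∘_)
open import Algebra.Bundles using (CommutativeRing)
open import Data.Bool using (Bool; true; false; T; _∧_; if_then_else_)
open import Data.Bool.Properties using (T-∧; T?)
open import Data.Empty using (⊥; ⊥-elim)
open import Data.Nat using (ℕ; zero; suc; _+_; _*_; _∸_; _≤_; _<_; _≡ᵇ_; _≤ᵇ_; _<ᵇ_; z≤n; s≤s; _/_)
import Data.Nat.Properties as ℕ
import Data.Nat.DivMod as DivMod
open import Data.Nat.Induction using (<-rec)
open import Data.Nat.ListAction using (sum)
open import Data.Nat.ListAction.Properties using (sum-++)
open import Data.Nat.Combinatorics using (_C_; nCk+nC[k+1]≡[n+1]C[k+1])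
open import Data.Nat.Tactic.RingSolver using (solve-∀)
open import Data.List
  using (List; []; _∷_; _++_; length; map; concat; concatMap; filterᵇ; replicate; upTo; applyUpTo; take; drop; null; zip; cartesianProduct)
import Data.List.Properties as List
open import Data.List.Relation.Unary.All using (All; []; _∷_) renaming (map to All-map)
import Data.List.Relation.Unary.All.Properties as All
open import Data.Product using (_×_; _,_; proj₁; proj₂; Σ-syntax)
open import Data.Sum using (_⊎_; inj₁; inj₂)
open import Function.Bundles using (Equivalence)
open import Relation.Binary.Definitions using (Tri; tri<; tri≈; tri>)
open import Relation.Binary.PropositionalEquality as ≡ using (_≡_; _≢_)
open import Relation.Nullary using (¬_; yes; no)
open import Defs

T-ext : ∀ {a b} → (T a → T b) → (T b → T a) → a ≡ b
T-ext {true}  {true}  _ _ = ≡.refl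
T-ext {true}  {false} f _ = ⊥-elim (f _)
T-ext {false} {true}  _ g = ⊥-elim (g _)
T-ext {false} {false} _ _ = ≡.refl

T-∧-intro : ∀ {a b} → T a → T b → T (a ∧ b)
T-∧-intro p q = Equivalence.from T-∧ (p , q)

T-∧-fst : ∀ {a b} → T (a ∧ b) → T a
T-∧-fst = proj₁ ∘ Equivalence.to T-∧

T-∧-snd : ∀ {a b} → T (a ∧ b) → T b
T-∧-snd = proj₂ ∘ Equivalence.to T-∧

≡ᵇ-sym : ∀ a b → (a ≡ᵇ b) ≡ (b ≡ᵇ a)
≡ᵇ-sym a b = T-ext (ℕ.≡⇒≡ᵇ b a ∘ ≡.sym ∘ ℕ.≡ᵇ⇒≡ a b) (ℕ.≡⇒≡ᵇ a b ∘ ≡.sym ∘ ℕ.≡ᵇ⇒≡ b a)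

+≡ᵇ-split : ∀ L a N → (L + a ≡ᵇ N) ≡ (L ≤ᵇ N) ∧ (a ≡ᵇ N ∸ L)
+≡ᵇ-split L a N = T-ext to from
  where
    to : T (L + a ≡ᵇ N) → T ((L ≤ᵇ N) ∧ (a ≡ᵇ N ∸ L))
    to p with ℕ.≡ᵇ⇒≡ (L + a) N p
    ... | ≡.refl = T-∧-intro (ℕ.≤⇒≤ᵇ (ℕ.m≤m+n L a)) (ℕ.≡⇒≡ᵇ a _ (≡.sym (ℕ.m+n∸m≡n L a)))
    from : T ((L ≤ᵇ N) ∧ (a ≡ᵇ N ∸ L)) → T (L + a ≡ᵇ N)
    from p with ℕ.≡ᵇ⇒≡ a (N ∸ L) (T-∧-snd {L ≤ᵇ N} p)
    ... | ≡.refl = ℕ.≡⇒≡ᵇ (L + (N ∸ L)) N (ℕ.m+[n∸m]≡n (ℕ.≤ᵇ⇒≤ L N (T-∧-fst p)))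

+-cancelʳ-≡ᵇ : ∀ a b k → (a + k ≡ᵇ b + k) ≡ (a ≡ᵇ b)
+-cancelʳ-≡ᵇ a b k = T-ext (ℕ.≡⇒≡ᵇ a b ∘ ℕ.+-cancelʳ-≡ k a b ∘ ℕ.≡ᵇ⇒≡ (a + k) (b + k))
                           (ℕ.≡⇒≡ᵇ (a + k) (b + k) ∘ ≡.cong (_+ k) ∘ ℕ.≡ᵇ⇒≡ a b)

≤ᵇ-∸ : ∀ {a n} x → a ≤ n → (x ≤ᵇ n ∸ a) ≡ (a + x ≤ᵇ n)
≤ᵇ-∸ {a} {n} x a≤n = T-ext
  (λ p → ℕ.≤⇒≤ᵇ (ℕ.≤-trans (ℕ.+-monoʳ-≤ a (ℕ.≤ᵇ⇒≤ x _ p)) (ℕ.≤-reflexive (ℕ.m+[n∸m]≡n a≤n))))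
  (λ p → ℕ.≤⇒≤ᵇ (ℕ.m+n≤o⇒m≤o∸n x (ℕ.≤-trans (ℕ.≤-reflexive (ℕ.+-comm x a)) (ℕ.≤ᵇ⇒≤ (a + x) n p))))

+∸-< : ∀ {w} → 0 < w → ∀ n x → n < x → n + w ∸ x < w
+∸-< {suc w} _   zero    (suc x) _         = s≤s (ℕ.m∸n≤m w x)
+∸-< w>0         (suc n) (suc x) (s≤s n<x) = +∸-< w>0 n x n<x

+∸-+ : ∀ {a m n w x} → a + m ≡ n → x ≤ m → n + w ∸ (a + x) ≡ m ∸ x + w
+∸-+ {a} {m} {n} {w} {x} a+m≡n x≤m = begin
    n + w ∸ (a + x)         ≡⟨ ≡.cong (λ q → q + w ∸ (a + x)) (≡.sym a+m≡n) ⟩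
    a + m + w ∸ (a + x)     ≡⟨ ≡.cong (_∸ (a + x)) (ℕ.+-assoc a m w) ⟩
    a + (m + w) ∸ (a + x)   ≡⟨ ℕ.[m+n]∸[m+o]≡n∸o a (m + w) x ⟩
    m + w ∸ x               ≡⟨ ℕ.+-∸-comm w x≤m ⟩
    m ∸ x + w               ∎
  where open ≡.≡-Reasoning

≤/⇒*≤ : ∀ {d i n} → i ≤ n / suc d → suc d * i ≤ n
≤/⇒*≤ {d} {i} {n} i≤n/d = ℕ.≤-trans (ℕ.≤-reflexive (ℕ.*-comm (suc d) i))
                            (ℕ.≤-trans (ℕ.*-monoˡ-≤ (suc d) i≤n/d) (DivMod.m/n*n≤m n (suc d)))

*≤⇒≤/ : ∀ {d i n} → suc d * i ≤ n → i ≤ n / suc d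
*≤⇒≤/ {d} {i} {n} di≤n = ℕ.≤-trans (ℕ.≤-reflexive (≡.sym (DivMod.m*n/n≡m i (suc d))))
                            (DivMod./-monoˡ-≤ (suc d) (ℕ.≤-trans (ℕ.≤-reflexive (ℕ.*-comm i (suc d))) di≤n))

-- The cycle lemma

module _ {X : Set} where
  open ≡ using (refl; cong; cong₂; trans; sym)

  init : List X → List X
  init []           = []
  init (t ∷ [])     = []
  init (t ∷ u ∷ x) = t ∷ init (u ∷ x)

  init-++ : (y z : List X) → z ≢ [] → init (y ++ z) ≡ y ++ init z
  init-++ []           z       z≢[] = refl
  init-++ (t ∷ [])     []      z≢[] = ⊥-elim (z≢[] refl)
  init-++ (t ∷ [])     (u ∷ z) z≢[] = refl
  init-++ (t ∷ u ∷ y) z       z≢[] = cong (t ∷_) (init-++ (u ∷ y) z z≢[])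

  rotate : ℕ → List X → List X
  rotate r x = drop r x ++ take r x

  drop-length-++ : (y z : List X) → drop (length y) (y ++ z) ≡ z
  drop-length-++ []      z = refl
  drop-length-++ (t ∷ y) z = drop-length-++ y z

  take-length-++ : (y z : List X) → take (length y) (y ++ z) ≡ y
  take-length-++ []      z = refl
  take-length-++ (t ∷ y) z = cong (t ∷_) (take-length-++ y z)

  rotate-++ : (y z : List X) → rotate (length y) (y ++ z) ≡ z ++ y
  rotate-++ y z = cong₂ _++_ (drop-length-++ y z) (take-length-++ y z)

-- Walks in which the letter t moves from height h to height h + c t - 1.  From height h,
-- `exits h x` says that x stays at heights ≥ 0 and reaches -1 exactly with its last letter,
-- `stays h x` that x never goes below 0.  The auxiliary exits⁺ and stays⁺ receive the new
-- height plus one, so that no subtraction occurs.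
module Walk {X : Set} (c : X → ℕ) where
  open ≡ using (refl; sym; trans; cong; subst)

  charge : List X → ℕ
  charge x = sum (map c x)

  mutual
    exits : ℕ → List X → Bool
    exits h []      = false
    exits h (t ∷ x) = exits⁺ (h + c t) x

    exits⁺ : ℕ → List X → Bool
    exits⁺ zero    x = null x
    exits⁺ (suc h) x = exits h x

  mutual
    stays : ℕ → List X → Bool
    stays h []      = true
    stays h (t ∷ x) = stays⁺ (h + c t) x

    stays⁺ : ℕ → List X → Bool
    stays⁺ zero    x = false
    stays⁺ (suc h) x = stays h x

  endsOneLower : List X → Bool
  endsOneLower x = suc (charge x) ≡ᵇ length x

  suffixesDescend : List X → Bool
  suffixesDescend []      = true
  suffixesDescend (t ∷ y) = suffixesDescend y ∧ (charge (t ∷ y) <ᵇ length (t ∷ y))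

  private
    shift : ∀ h a {k} m → h + a ≡ k → h + (a + m) ≡ k + m
    shift h a m e = trans (sym (ℕ.+-assoc h a m)) (cong (_+ m) e)

  charge-++ : ∀ y z → charge (y ++ z) ≡ charge y + charge z
  charge-++ y z = trans (cong sum (List.map-++ c y z)) (sum-++ (map c y) (map c z))

  exits-length : ∀ h x → T (exits h x) → suc (h + charge x) ≡ length x
  exits-length h (t ∷ x) p with h + c t in eq
  exits-length h (t ∷ [])    p  | zero  = cong suc (shift h (c t) 0 eq)
  exits-length h (t ∷ _ ∷ _) () | zero
  exits-length h (t ∷ x)     p  | suc k = cong suc (trans (shift h (c t) _ eq) (exits-length k x p))

  stays-length : ∀ h z → T (stays h z) → length z ≤ h + charge z
  stays-length h []      _ = z≤n
  stays-length h (t ∷ z) p with h + c t in eq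
  stays-length h (t ∷ z) () | zero
  stays-length h (t ∷ z) p  | suc k = ℕ.≤-trans (s≤s (stays-length k z p)) (ℕ.≤-reflexive (sym (shift h (c t) _ eq)))

  stays-mono : ∀ {h h′} z → h ≤ h′ → T (stays h z) → T (stays h′ z)
  stays-mono []      _    _ = _
  stays-mono {h} {h′} (t ∷ z) h≤h′ p = go (ℕ.+-monoˡ-≤ (c t) h≤h′) p
    where
      go : ∀ {k k′} → k ≤ k′ → T (stays⁺ k z) → T (stays⁺ k′ z)
      go {suc k} {suc k′} (s≤s k≤k′) q = stays-mono z k≤k′ q

  exits-++ : ∀ h z y → y ≢ [] → exits h (z ++ y) ≡ stays h z ∧ exits (h + charge z ∸ length z) y
  exits-++ h [] y _ = cong (λ q → exits q y) (sym (ℕ.+-identityʳ h))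
  exits-++ h (t ∷ z) y y≢[] with h + c t in eq
  ... | zero  = null-++ z y≢[]
    where
      null-++ : ∀ z {y} → y ≢ [] → null (z ++ y) ≡ false
      null-++ [] {[]} y≢[] = ⊥-elim (y≢[] refl)
      null-++ [] {_ ∷ _} _ = refl
      null-++ (_ ∷ _) _ = refl
  ... | suc k = trans (exits-++ k z y y≢[])
                      (cong (λ q → stays k z ∧ exits (q ∸ suc (length z)) y) (sym (shift h (c t) _ eq)))

  stays-++ : ∀ h y z → stays h (y ++ z) ≡ stays h y ∧ stays (h + charge y ∸ length y) z
  stays-++ h [] z = cong (λ q → stays q z) (sym (ℕ.+-identityʳ h))
  stays-++ h (t ∷ y) z with h + c t in eq
  ... | zero  = refl
  ... | suc k = trans (stays-++ k y z)
                      (cong (λ q → stays k y ∧ stays (q ∸ suc (length y)) z) (sym (shift h (c t) _ eq)))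

  suffixesDescend-head : ∀ t y → T (suffixesDescend (t ∷ y)) → charge (t ∷ y) < length (t ∷ y)
  suffixesDescend-head t y p = ℕ.<ᵇ⇒< _ _ (T-∧-snd {suffixesDescend y} p)

  suffixesDescend⇒charge≤length : ∀ y → T (suffixesDescend y) → charge y ≤ length y
  suffixesDescend⇒charge≤length []      _ = z≤n
  suffixesDescend⇒charge≤length (t ∷ y) p = ℕ.<⇒≤ (suffixesDescend-head t y p)

  suffixesDescend-++ʳ : ∀ a b → T (suffixesDescend (a ++ b)) → T (suffixesDescend b)
  suffixesDescend-++ʳ []      b p = p
  suffixesDescend-++ʳ (t ∷ a) b p = suffixesDescend-++ʳ a b (T-∧-fst p)

  exits⇒suffixesDescend : ∀ h y → T (exits h y) → T (suffixesDescend y)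
  exits⇒suffixesDescend h (t ∷ y) p = T-∧-intro (rest (h + c t) y p) (ℕ.<⇒<ᵇ descends)
    where
      rest : ∀ k y → T (exits⁺ k y) → T (suffixesDescend y)
      rest zero    [] _ = _
      rest (suc k) y  q = exits⇒suffixesDescend k y q
      descends : c t + charge y < suc (length y)
      descends = s≤s (ℕ.≤-trans (ℕ.m≤n+m _ h) (ℕ.≤-reflexive (ℕ.suc-injective (exits-length h (t ∷ y) p))))

  suffixesDescend⇒exits : ∀ h y → y ≢ [] → T (suffixesDescend y) → suc (h + charge y) ≡ length y → T (exits h y)
  suffixesDescend⇒exits h [] y≢[] _ _ = ⊥-elim (y≢[] refl)
  suffixesDescend⇒exits h (t ∷ y) _ p total with h + c t in eq
  ... | zero with y
  ...   | []    = _
  ...   | u ∷ y = ⊥-elim (ℕ.<-irrefl (trans (sym (shift h (c t) _ eq)) (ℕ.suc-injective total))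
                                     (suffixesDescend-head u y (T-∧-fst p)))
  suffixesDescend⇒exits h (t ∷ [])    _ p total | suc k = ⊥-elim (ℕ.1+n≢0 (trans (sym (shift h (c t) 0 eq)) (ℕ.suc-injective total)))
  suffixesDescend⇒exits h (t ∷ u ∷ y) _ p total | suc k =
    suffixesDescend⇒exits k (u ∷ y) (λ ()) (T-∧-fst p) (trans (sym (shift h (c t) _ eq)) (ℕ.suc-injective total))

  suffixesDescend⇒stays : ∀ h y → T (suffixesDescend y) → length y ≤ h + charge y → T (stays h y)
  suffixesDescend⇒stays h []      _ _ = _
  suffixesDescend⇒stays h (t ∷ y) p len≤ with h + c t in eq
  ... | zero  = ⊥-elim (ℕ.<-irrefl refl (ℕ.≤-trans (ℕ.≤-trans len≤ (ℕ.≤-reflexive (shift h (c t) _ eq)))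
                                                   (ℕ.≤-trans (ℕ.m≤n+m (charge y) (c t)) (ℕ.≤-pred (suffixesDescend-head t y p)))))
  ... | suc k = suffixesDescend⇒stays k y (T-∧-fst p) (ℕ.≤-pred (ℕ.≤-trans len≤ (ℕ.≤-reflexive (shift h (c t) _ eq))))

  stays-init⇒exits : ∀ h z → z ≢ [] → T (stays h (init z)) → suc (h + charge z) ≡ length z → T (exits h z)
  stays-init⇒exits h [] z≢[] _ _ = ⊥-elim (z≢[] refl)
  stays-init⇒exits h (t ∷ []) _ _ total with h + c t in eq
  ... | zero  = _
  ... | suc k = ⊥-elim (ℕ.1+n≢0 (trans (sym (shift h (c t) 0 eq)) (ℕ.suc-injective total)))
  stays-init⇒exits h (t ∷ z@(_ ∷ _)) _ p total = go (h + c t) refl z (λ ()) p total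
    where
      go : ∀ k → h + c t ≡ k → ∀ z → z ≢ [] → T (stays⁺ k (init z)) →
           suc (h + (c t + charge z)) ≡ suc (length z) → T (exits⁺ k z)
      go (suc k) eq z z≢[] q total = stays-init⇒exits k z z≢[] q (trans (sym (shift h (c t) _ eq)) (ℕ.suc-injective total))

  stays-init⇒stays : ∀ h z → z ≢ [] → T (stays h (init z)) → length z ≤ h + charge z → T (stays h z)
  stays-init⇒stays h [] z≢[] _ _ = ⊥-elim (z≢[] refl)
  stays-init⇒stays h (t ∷ []) _ _ len≤ with h + c t in eq
  ... | zero with ℕ.≤-trans len≤ (ℕ.≤-reflexive (shift h (c t) 0 eq))
  ...   | ()
  stays-init⇒stays h (t ∷ []) _ _ len≤ | suc k = _
  stays-init⇒stays h (t ∷ z@(_ ∷ _)) _ p len≤ = go (h + c t) refl z (λ ()) p len≤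
    where
      go : ∀ k → h + c t ≡ k → ∀ z → z ≢ [] → T (stays⁺ k (init z)) →
           suc (length z) ≤ h + (c t + charge z) → T (stays⁺ k z)
      go (suc k) eq z z≢[] q len≤ = stays-init⇒stays k z z≢[] q (ℕ.≤-pred (ℕ.≤-trans len≤ (ℕ.≤-reflexive (shift h (c t) _ eq))))

  drop-≢[] : ∀ r (x : List X) → r < length x → drop r x ≢ []
  drop-≢[] zero    (t ∷ x) _         ()
  drop-≢[] (suc r) (t ∷ x) (s≤s r<) = drop-≢[] r x r<

  -- Either t prolongs the descending prefix found for x, or t lifts the walk high enough for
  -- all of init (t ∷ x) to stay nonnegative.
  descendingPrefix : ∀ x → x ≢ [] →
    Σ[ r ∈ ℕ ] r < length x × T (suffixesDescend (take r x)) × T (stays 0 (init (drop r x)))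
  descendingPrefix []                x≢[] = ⊥-elim (x≢[] refl)
  descendingPrefix (t ∷ [])          _    = 0 , s≤s z≤n , _ , _
  descendingPrefix (t ∷ x@(_ ∷ _)) _ with descendingPrefix x (λ ())
  ... | r , r<|x| , desc , st with c t + charge (take r x) ℕ.<? suc (length (take r x))
  ...   | yes lt = suc r , s≤s r<|x| , T-∧-intro desc (ℕ.<⇒<ᵇ lt) , st
  ...   | no ¬lt = 0 , s≤s z≤n , _ , stays-from (c t) refl
    where
      y : List X
      y = take r x
      z : List X
      z = drop r x
      init-x : init x ≡ y ++ init z
      init-x = trans (cong init (sym (List.take++drop≡id r x))) (init-++ y z (drop-≢[] r x r<|x|))
      climbs : ∀ {k} → c t ≡ k → suc (length y) ≤ k + charge y
      climbs refl = ℕ.≮⇒≥ ¬lt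
      stays-from : ∀ k → c t ≡ k → T (stays⁺ k (init x))
      stays-from zero    eq = ⊥-elim (ℕ.<-irrefl refl
                                (ℕ.<-≤-trans (climbs eq) (suffixesDescend⇒charge≤length y desc)))
      stays-from (suc k) eq = subst (T ∘ stays k) (sym init-x) (subst T (sym (stays-++ k y (init z)))
                                (T-∧-intro (suffixesDescend⇒stays k y desc (ℕ.≤-pred (climbs eq)))
                                           (stays-mono (init z) z≤n st)))

  exits-swap : ∀ z y → z ≢ [] → T (suffixesDescend y) → T (stays 0 (init z)) →
               suc (charge z + charge y) ≡ length z + length y → T (exits 0 (z ++ y))
  exits-swap z [] z≢[] _ st total =
    subst (T ∘ exits 0) (sym (List.++-identityʳ z))
          (stays-init⇒exits 0 z z≢[] st (trans (cong suc (sym (ℕ.+-identityʳ _))) (trans total (ℕ.+-identityʳ _))))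
  exits-swap z y@(t ∷ y′) z≢[] desc st total =
    subst T (sym (exits-++ 0 z y (λ ())))
          (T-∧-intro (stays-init⇒stays 0 z z≢[] st |z|≤) (suffixesDescend⇒exits D y (λ ()) desc total′))
    where
      |z|≤ : length z ≤ charge z
      |z|≤ = ℕ.+-cancelʳ-≤ (length y) (length z) (charge z)
               (ℕ.≤-trans (ℕ.≤-reflexive (sym total))
                 (ℕ.≤-trans (ℕ.≤-reflexive (sym (ℕ.+-suc (charge z) (charge y))))
                   (ℕ.+-monoʳ-≤ (charge z) (suffixesDescend-head t y′ desc))))
      D : ℕ
      D = charge z ∸ length z
      total′ : suc (D + charge y) ≡ length y
      total′ = ℕ.+-cancelʳ-≡ (length z) (suc (D + charge y)) (length y) (begin
          suc (D + charge y + length z)  ≡⟨ cong suc (ℕ.+-assoc D (charge y) (length z)) ⟩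
          suc (D + (charge y + length z)) ≡⟨ cong (λ q → suc (D + q)) (ℕ.+-comm (charge y) (length z)) ⟩
          suc (D + (length z + charge y)) ≡⟨ cong suc (sym (ℕ.+-assoc D (length z) (charge y))) ⟩
          suc (D + length z + charge y)  ≡⟨ cong (λ q → suc (q + charge y)) (ℕ.m∸n+n≡m |z|≤) ⟩
          suc (charge z + charge y)      ≡⟨ total ⟩
          length z + length y            ≡⟨ ℕ.+-comm (length z) (length y) ⟩
          length y + length z            ∎)
        where open ≡.≡-Reasoning

  charge-rotate : ∀ r x → charge (rotate r x) ≡ charge x
  charge-rotate r x = trans (charge-++ (drop r x) (take r x))
    (trans (ℕ.+-comm (charge (drop r x)) (charge (take r x)))
      (trans (sym (charge-++ (take r x) (drop r x))) (cong charge (List.take++drop≡id r x))))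

  length-rotate : ∀ r (x : List X) → length (rotate r x) ≡ length x
  length-rotate r x = trans (List.length-++ (drop r x))
    (trans (ℕ.+-comm (length (drop r x)) (length (take r x)))
      (trans (sym (List.length-++ (take r x))) (cong length (List.take++drop≡id r x))))

  exits-rotate⇒endsOneLower : ∀ r x → T (exits 0 (rotate r x)) → suc (charge x) ≡ length x
  exits-rotate⇒endsOneLower r x p =
    trans (cong suc (sym (charge-rotate r x))) (trans (exits-length 0 (rotate r x) p) (length-rotate r x))

  exiting-rotation-exists : ∀ x → suc (charge x) ≡ length x → Σ[ r ∈ ℕ ] r < length x × T (exits 0 (rotate r x))
  exiting-rotation-exists x total with descendingPrefix x x≢[]
    where
      x≢[] : x ≢ []
      x≢[] x≡[] = ℕ.1+n≢0 (trans total (cong length x≡[]))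
  ... | r , r<|x| , desc , st =
    r , r<|x| , exits-swap (drop r x) (take r x) (drop-≢[] r x r<|x|) desc st total′
    where
      total′ : suc (charge (drop r x) + charge (take r x)) ≡ length (drop r x) + length (take r x)
      total′ = trans (cong suc (sym (charge-++ (drop r x) (take r x))))
                     (trans (cong suc (charge-rotate r x))
                       (trans total (trans (sym (length-rotate r x)) (List.length-++ (drop r x)))))

  -- B would stay nonnegative in the first word and descend in the second.
  no-two-exits : ∀ A B D → B ≢ [] → D ≢ [] → T (exits 0 ((B ++ D) ++ A)) → T (exits 0 (D ++ (A ++ B))) → ⊥
  no-two-exits A []      D B≢[] _ _ _ = B≢[] refl
  no-two-exits A (b ∷ B) D _ D≢[] p q = ℕ.<-irrefl refl (ℕ.≤-<-trans |B|≤charge charge<|B|)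
    where
      stays-B : T (stays 0 (b ∷ B))
      stays-B = T-∧-fst (subst T (exits-++ 0 (b ∷ B) (D ++ A) (D≢[] ∘ List.++-conicalˡ D A)) p′)
        where
          p′ : T (exits 0 ((b ∷ B) ++ (D ++ A)))
          p′ = subst (T ∘ exits 0) (List.++-assoc (b ∷ B) D A) p
      |B|≤charge : length (b ∷ B) ≤ 0 + charge (b ∷ B)
      |B|≤charge = stays-length 0 (b ∷ B) stays-B
      charge<|B| : charge (b ∷ B) < length (b ∷ B)
      charge<|B| = suffixesDescend-head b B (suffixesDescend-++ʳ A (b ∷ B) (exits⇒suffixesDescend _ (A ++ b ∷ B)
                     (T-∧-snd {stays 0 D} (subst T (exits-++ 0 D (A ++ b ∷ B) ((λ ()) ∘ List.++-conicalʳ A (b ∷ B))) q))))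

  exiting-rotation-unique : ∀ x {r₁ r₂} → r₁ < r₂ → r₂ < length x →
                            T (exits 0 (rotate r₁ x)) → T (exits 0 (rotate r₂ x)) → ⊥
  exiting-rotation-unique x {r₁} {r₂} r₁<r₂ r₂<|x| p q =
    no-two-exits A B D B≢[] D≢[] (subst (T ∘ exits 0) rotate₁ p) (subst (λ w → T (exits 0 (D ++ w))) (sym A++B) q)
    where
      Y : List X
      Y = take r₂ x
      D : List X
      D = drop r₂ x
      A : List X
      A = take r₁ Y
      B : List X
      B = drop r₁ Y
      |Y| : length Y ≡ r₂
      |Y| = trans (List.length-take r₂ x) (ℕ.m≤n⇒m⊓n≡m (ℕ.<⇒≤ r₂<|x|))
      |A| : length A ≡ r₁
      |A| = trans (List.length-take r₁ Y) (ℕ.m≤n⇒m⊓n≡m (ℕ.≤-trans (ℕ.<⇒≤ r₁<r₂) (ℕ.≤-reflexive (sym |Y|))))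
      B≢[] : B ≢ []
      B≢[] = drop-≢[] r₁ Y (ℕ.<-≤-trans r₁<r₂ (ℕ.≤-reflexive (sym |Y|)))
      D≢[] : D ≢ []
      D≢[] = drop-≢[] r₂ x r₂<|x|
      A++B : A ++ B ≡ Y
      A++B = List.take++drop≡id r₁ Y
      A++B++D : A ++ (B ++ D) ≡ x
      A++B++D = trans (sym (List.++-assoc A B D)) (trans (cong (_++ D) A++B) (List.take++drop≡id r₂ x))
      rotate₁ : rotate r₁ x ≡ (B ++ D) ++ A
      rotate₁ = trans (≡.cong₂ rotate (sym |A|) (sym A++B++D)) (rotate-++ A (B ++ D))

words-fuel : ∀ A {f₁ f₂} n → n ≤ f₁ → n ≤ f₂ → words f₁ A n ≡ words f₂ A n
words-fuel A zero _ _ = ≡.refl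
words-fuel A {suc f₁} {suc f₂} (suc n) (s≤s n≤f₁) (s≤s n≤f₂) = List.concatMap-cong firstStep A
  where
    firstStep : ∀ a → (if len a ≡ᵇ 0 then [] else if len a ≤ᵇ suc n then map (a ∷_) (words f₁ A (suc n ∸ len a)) else [])
                    ≡ (if len a ≡ᵇ 0 then [] else if len a ≤ᵇ suc n then map (a ∷_) (words f₂ A (suc n ∸ len a)) else [])
    firstStep a with len a
    ... | zero  = ≡.refl
    ... | suc l = ≡.cong (λ ws → if suc l ≤ᵇ suc n then map (a ∷_) ws else [])
                         (words-fuel A (n ∸ l) (ℕ.≤-trans (ℕ.m∸n≤m n l) n≤f₁) (ℕ.≤-trans (ℕ.m∸n≤m n l) n≤f₂))

moveCharge : Move → ℕ
moveCharge (up t) = suc t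
moveCharge down   = 0

moveCharge≡0⇒down : ∀ {mv} → moveCharge mv ≡ 0 → mv ≡ down
moveCharge≡0⇒down {down} _ = ≡.refl

isDown : Step → Bool
isDown b = moveCharge (move b) ≡ᵇ 0

upCount : Move → ℕ
upCount (up _) = 1
upCount down   = 0

downCount : Move → ℕ
downCount (up _) = 0
downCount down   = 1

IsNonU : Step → Set
IsNonU b = inU b ≡ false × 1 ≤ len b

NonUStep : ℕ → Step → Set
NonUStep w b = IsNonU b × (move b ≡ down → len b ≡ w)

module _ {c ℓ : Level} (R : CommutativeRing c ℓ) where
  open CommutativeRing R renaming (_+_ to _+R_; _*_ to _*R_) hiding (zero)
  open import Relation.Binary.Reasoning.Setoid setoid
  open import Algebra.Properties.CommutativeSemigroup *-commutativeSemigroup using (x∙yz≈y∙xz)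
  open import Algebra.Properties.CommutativeSemigroup +-commutativeSemigroup using (interchange)

  infix 5 ∑ ∑< ∑^

  fromℕ-+ : ∀ a b → fromℕ R (a + b) ≈ fromℕ R a +R fromℕ R b
  fromℕ-+ zero    b = sym (+-identityˡ _)
  fromℕ-+ (suc a) b = trans (+-congˡ (fromℕ-+ a b)) (sym (+-assoc _ _ _))

  Πl-++ : (xs ys : List Carrier) → Πl R (xs ++ ys) ≈ Πl R xs *R Πl R ys
  Πl-++ []       ys = sym (*-identityˡ _)
  Πl-++ (x ∷ xs) ys = trans (*-congˡ (Πl-++ xs ys)) (sym (*-assoc _ _ _))

  Πl-ones : ∀ {A : Set} (xs : List A) → Πl R (map (λ _ → 1#) xs) ≈ 1#
  Πl-ones []       = refl
  Πl-ones (x ∷ xs) = trans (*-identityˡ _) (Πl-ones xs)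

  𝟙 : Bool → Carrier
  𝟙 true  = 1#
  𝟙 false = 0#

  𝟙-∧ : ∀ a b → 𝟙 (a ∧ b) ≈ 𝟙 a *R 𝟙 b
  𝟙-∧ true  b = sym (*-identityˡ _)
  𝟙-∧ false b = sym (zeroˡ _)

  𝟙-T : ∀ {b} → T b → 𝟙 b ≈ 1#
  𝟙-T {true} _ = refl

  𝟙-¬T : ∀ {b} → ¬ T b → 𝟙 b ≈ 0#
  𝟙-¬T {true}  ¬b = ⊥-elim (¬b _)
  𝟙-¬T {false} _  = refl

  𝟙-T-* : ∀ {b} → T b → ∀ x → 𝟙 b *R x ≈ x
  𝟙-T-* b x = trans (*-congʳ (𝟙-T b)) (*-identityˡ x)

  𝟙-¬T-* : ∀ {b} → ¬ T b → ∀ x → 𝟙 b *R x ≈ 0#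
  𝟙-¬T-* ¬b x = trans (*-congʳ (𝟙-¬T ¬b)) (zeroˡ x)

  𝟙≡-* : ∀ {m n} → m ≡ n → ∀ x → 𝟙 (m ≡ᵇ n) *R x ≈ x
  𝟙≡-* {m} {n} m≡n = 𝟙-T-* (ℕ.≡⇒≡ᵇ m n m≡n)

  𝟙≢-* : ∀ {m n} → m ≢ n → ∀ x → 𝟙 (m ≡ᵇ n) *R x ≈ 0#
  𝟙≢-* {m} {n} m≢n = 𝟙-¬T-* (m≢n ∘ ℕ.≡ᵇ⇒≡ m n)

  𝟙≤-* : ∀ {m n} → m ≤ n → ∀ x → 𝟙 (m ≤ᵇ n) *R x ≈ x
  𝟙≤-* m≤n = 𝟙-T-* (ℕ.≤⇒≤ᵇ m≤n)

  𝟙>-* : ∀ {m n} → n < m → ∀ x → 𝟙 (m ≤ᵇ n) *R x ≈ 0#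
  𝟙>-* {m} {n} n<m = 𝟙-¬T-* (λ m≤ᵇn → ℕ.<⇒≱ n<m (ℕ.≤ᵇ⇒≤ m n m≤ᵇn))

  ∑ : {A : Set} → List A → (A → Carrier) → Carrier
  ∑ xs g = Σl R (map g xs)

  syntax ∑ xs (λ x → e) = ∑[ x ∈ xs ] e

  module _ {A : Set} where

    ∑-cong : (xs : List A) {g h : A → Carrier} → (∀ x → g x ≈ h x) → ∑ xs g ≈ ∑ xs h
    ∑-cong []       _ = refl
    ∑-cong (x ∷ xs) e = +-cong (e x) (∑-cong xs e)

    ∑-cong-All : {Q : A → Set} (xs : List A) → All Q xs → {g h : A → Carrier} →
                 (∀ x → Q x → g x ≈ h x) → ∑ xs g ≈ ∑ xs h
    ∑-cong-All []       []         _ = refl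
    ∑-cong-All (x ∷ xs) (qx ∷ qxs) e = +-cong (e x qx) (∑-cong-All xs qxs e)

    ∑-zero : (xs : List A) {g : A → Carrier} → (∀ x → g x ≈ 0#) → ∑ xs g ≈ 0#
    ∑-zero []       _ = refl
    ∑-zero (x ∷ xs) e = trans (+-cong (e x) (∑-zero xs e)) (+-identityˡ _)

    ∑-++ : (xs ys : List A) (g : A → Carrier) → ∑ (xs ++ ys) g ≈ ∑ xs g +R ∑ ys g
    ∑-++ []       ys g = sym (+-identityˡ _)
    ∑-++ (x ∷ xs) ys g = trans (+-congˡ (∑-++ xs ys g)) (sym (+-assoc _ _ _))

    ∑-map : {B : Set} (xs : List B) (k : B → A) (g : A → Carrier) → ∑ (map k xs) g ≡ ∑ xs (g ∘ k)
    ∑-map []       k g = ≡.refl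
    ∑-map (x ∷ xs) k g = ≡.cong (g (k x) +R_) (∑-map xs k g)

    ∑-concatMap : {B : Set} (xs : List B) (k : B → List A) (g : A → Carrier) →
                  ∑ (concatMap k xs) g ≈ ∑[ x ∈ xs ] ∑ (k x) g
    ∑-concatMap []       k g = refl
    ∑-concatMap (x ∷ xs) k g = trans (∑-++ (k x) (concatMap k xs) g) (+-congˡ (∑-concatMap xs k g))

    ∑-+ : (xs : List A) (g h : A → Carrier) → ∑[ x ∈ xs ] (g x +R h x) ≈ ∑ xs g +R ∑ xs h
    ∑-+ []       g h = sym (+-identityˡ _)
    ∑-+ (x ∷ xs) g h = trans (+-congˡ (∑-+ xs g h)) (interchange (g x) (h x) (∑ xs g) (∑ xs h))

    ∑-distribˡ : (xs : List A) (a : Carrier) (g : A → Carrier) → a *R ∑ xs g ≈ ∑[ x ∈ xs ] a *R g x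
    ∑-distribˡ []       a g = zeroʳ a
    ∑-distribˡ (x ∷ xs) a g = trans (distribˡ _ _ _) (+-congˡ (∑-distribˡ xs a g))

    ∑-distribʳ : (xs : List A) (a : Carrier) (g : A → Carrier) → ∑ xs g *R a ≈ ∑[ x ∈ xs ] g x *R a
    ∑-distribʳ xs a g = trans (*-comm _ _) (trans (∑-distribˡ xs a g) (∑-cong xs (λ x → *-comm _ _)))

    ∑-filterᵇ : (p : A → Bool) (xs : List A) (g : A → Carrier) → ∑ (filterᵇ p xs) g ≈ ∑[ x ∈ xs ] 𝟙 (p x) *R g x
    ∑-filterᵇ p []       g = refl
    ∑-filterᵇ p (x ∷ xs) g with p x
    ... | true  = +-cong (sym (*-identityˡ _)) (∑-filterᵇ p xs g)
    ... | false = trans (∑-filterᵇ p xs g) (trans (sym (+-identityˡ _)) (+-congʳ (sym (zeroˡ _))))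

    ∑-replicate : (k : ℕ) (x : A) (g : A → Carrier) → ∑ (replicate k x) g ≈ fromℕ R k *R g x
    ∑-replicate zero    x g = sym (zeroˡ _)
    ∑-replicate (suc k) x g = trans (+-cong (sym (*-identityˡ _)) (∑-replicate k x g)) (sym (distribʳ _ _ _))

  ∑-𝟙 : {A : Set} (p : A → Bool) (xs : List A) → ∑[ x ∈ xs ] 𝟙 (p x) ≈ fromℕ R (length (filterᵇ p xs))
  ∑-𝟙 p []       = refl
  ∑-𝟙 p (x ∷ xs) with p x
  ... | true  = +-congˡ (∑-𝟙 p xs)
  ... | false = trans (+-identityˡ _) (∑-𝟙 p xs)

  ∑-zero-All : {A : Set} {Q : A → Set} (xs : List A) → All Q xs → {g : A → Carrier} →
               (∀ x → Q x → g x ≈ 0#) → ∑ xs g ≈ 0#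
  ∑-zero-All []       []         _ = refl
  ∑-zero-All (x ∷ xs) (qx ∷ qxs) e = trans (+-cong (e x qx) (∑-zero-All xs qxs e)) (+-identityˡ _)

  ∑-cartesianProduct : {A B : Set} (xs : List A) (ys : List B) (g : A × B → Carrier) →
                       ∑ (cartesianProduct xs ys) g ≈ ∑[ x ∈ xs ] ∑[ y ∈ ys ] g (x , y)
  ∑-cartesianProduct []       ys g = refl
  ∑-cartesianProduct (x ∷ xs) ys g = trans (∑-++ (map (x ,_) ys) (cartesianProduct xs ys) g)
                                           (+-cong (reflexive (∑-map ys (x ,_) g)) (∑-cartesianProduct xs ys g))

  Σl-concatMap : {A : Set} (xs : List A) (k : A → List Carrier) → Σl R (concatMap k xs) ≈ ∑[ x ∈ xs ] Σl R (k x)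
  Σl-concatMap []       k = refl
  Σl-concatMap (x ∷ xs) k = trans (Σl-++ (k x) (concatMap k xs)) (+-congˡ (Σl-concatMap xs k))
    where
      Σl-++ : (ys zs : List Carrier) → Σl R (ys ++ zs) ≈ Σl R ys +R Σl R zs
      Σl-++ []       zs = sym (+-identityˡ _)
      Σl-++ (y ∷ ys) zs = trans (+-congˡ (Σl-++ ys zs)) (sym (+-assoc _ _ _))

  Σl-if : ∀ b x → Σl R (if b then x ∷ [] else []) ≈ 𝟙 b *R x
  Σl-if true  x = trans (+-identityʳ x) (sym (*-identityˡ x))
  Σl-if false x = sym (zeroˡ x)

  ∑-comm : {A B : Set} (xs : List A) (ys : List B) (h : A → B → Carrier) →
           ∑[ x ∈ xs ] ∑[ y ∈ ys ] h x y ≈ ∑[ y ∈ ys ] ∑[ x ∈ xs ] h x y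
  ∑-comm []       ys h = sym (∑-zero ys (λ _ → refl))
  ∑-comm (x ∷ xs) ys h = trans (+-congˡ (∑-comm xs ys h)) (sym (∑-+ ys (h x) (λ y → ∑[ x ∈ xs ] h x y)))

  ∑< : ℕ → (ℕ → Carrier) → Carrier
  ∑< zero    g = 0#
  ∑< (suc n) g = g 0 +R ∑< n (g ∘ suc)

  syntax ∑< n (λ i → e) = ∑[ i < n ] e

  ∑-upTo : (n : ℕ) (g : ℕ → Carrier) → ∑ (upTo n) g ≡ ∑< n g
  ∑-upTo = go (λ i → i)
    where
      go : (k : ℕ → ℕ) (n : ℕ) (g : ℕ → Carrier) → ∑ (applyUpTo k n) g ≡ ∑< n (g ∘ k)
      go k zero    g = ≡.refl
      go k (suc n) g = ≡.cong (g (k 0) +R_) (go (k ∘ suc) n g)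

  ∑<-cong : (n : ℕ) {g h : ℕ → Carrier} → (∀ i → i < n → g i ≈ h i) → ∑< n g ≈ ∑< n h
  ∑<-cong zero    e = refl
  ∑<-cong (suc n) e = +-cong (e 0 (s≤s z≤n)) (∑<-cong n (λ i i<n → e (suc i) (s≤s i<n)))

  ∑<-zero : (n : ℕ) {g : ℕ → Carrier} → (∀ i → i < n → g i ≈ 0#) → ∑< n g ≈ 0#
  ∑<-zero zero    e = refl
  ∑<-zero (suc n) e = trans (+-cong (e 0 (s≤s z≤n)) (∑<-zero n (λ i i<n → e (suc i) (s≤s i<n)))) (+-identityˡ _)

  ∑<-+ : (n : ℕ) (g h : ℕ → Carrier) → ∑[ i < n ] (g i +R h i) ≈ ∑< n g +R ∑< n h
  ∑<-+ n g h = ≡.subst₂ _≈_ (∑-upTo n _) (≡.cong₂ _+R_ (∑-upTo n g) (∑-upTo n h)) (∑-+ (upTo n) g h)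

  ∑<-distribˡ : (n : ℕ) (a : Carrier) (g : ℕ → Carrier) → a *R ∑< n g ≈ ∑[ i < n ] a *R g i
  ∑<-distribˡ n a g = ≡.subst₂ (λ l r → a *R l ≈ r) (∑-upTo n g) (∑-upTo n _) (∑-distribˡ (upTo n) a g)

  ∑<-comm : (n m : ℕ) (h : ℕ → ℕ → Carrier) → ∑[ i < n ] ∑[ j < m ] h i j ≈ ∑[ j < m ] ∑[ i < n ] h i j
  ∑<-comm zero    m h = sym (∑<-zero m (λ _ _ → refl))
  ∑<-comm (suc n) m h = trans (+-congˡ (∑<-comm n m (h ∘ suc))) (sym (∑<-+ m (h 0) (λ j → ∑[ i < n ] h (suc i) j)))

  ∑-∑<-comm : {A : Set} (xs : List A) (n : ℕ) (h : A → ℕ → Carrier) →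
              ∑[ x ∈ xs ] ∑< n (h x) ≈ ∑[ i < n ] ∑[ x ∈ xs ] h x i
  ∑-∑<-comm xs zero    h = ∑-zero xs (λ _ → refl)
  ∑-∑<-comm xs (suc n) h = trans (∑-+ xs _ _) (+-congˡ (∑-∑<-comm xs n (λ x i → h x (suc i))))

  ∑<-const : (n : ℕ) (a : Carrier) → ∑[ i < n ] a ≈ fromℕ R n *R a
  ∑<-const zero    a = sym (zeroˡ a)
  ∑<-const (suc n) a = trans (+-cong (sym (*-identityˡ a)) (∑<-const n a)) (sym (distribʳ a 1# (fromℕ R n)))

  ∑<-truncate : (m n : ℕ) (g : ℕ → Carrier) → m ≤ n → (∀ i → m ≤ i → i < n → g i ≈ 0#) → ∑< n g ≈ ∑< m g
  ∑<-truncate zero    n       g _         z = ∑<-zero n (λ i → z i z≤n)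
  ∑<-truncate (suc m) (suc n) g (s≤s m≤n) z =
    +-congˡ (∑<-truncate m n (g ∘ suc) m≤n (λ i m≤i i<n → z (suc i) (s≤s m≤i) (s≤s i<n)))

  ∑<-single : (n k : ℕ) (g : ℕ → Carrier) → k < n → (∀ i → i < n → i ≢ k → g i ≈ 0#) → ∑< n g ≈ g k
  ∑<-single (suc n) zero    g _ z =
    trans (+-congˡ (∑<-zero n (λ i i<n → z (suc i) (s≤s i<n) (λ ())))) (+-identityʳ _)
  ∑<-single (suc n) (suc k) g (s≤s k<n) z =
    trans (+-cong (z 0 (s≤s z≤n) (λ ())) (∑<-single n k (g ∘ suc) k<n (λ i i<n i≢k → z (suc i) (s≤s i<n) (i≢k ∘ ℕ.suc-injective))))
          (+-identityˡ _)

  ∑<-select : (n a b : ℕ) (g : ℕ → Carrier) → b < a + n → ∑[ i < n ] 𝟙 (a + i ≡ᵇ b) *R g i ≈ 𝟙 (a ≤ᵇ b) *R g (b ∸ a)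
  ∑<-select n a b g b<a+n with a ℕ.≤? b
  ... | Relation.Nullary.yes a≤b = begin
      ∑[ i < n ] 𝟙 (a + i ≡ᵇ b) *R g i   ≈⟨ ∑<-single n (b ∸ a) _ (ℕ.+-cancelˡ-< a _ _ b-a+a<a+n) others ⟩
      𝟙 (a + (b ∸ a) ≡ᵇ b) *R g (b ∸ a)  ≈⟨ 𝟙≡-* (ℕ.m+[n∸m]≡n a≤b) _ ⟩
      g (b ∸ a)                           ≈⟨ sym (𝟙≤-* a≤b _) ⟩
      𝟙 (a ≤ᵇ b) *R g (b ∸ a)             ∎
    where
      b-a+a<a+n : a + (b ∸ a) < a + n
      b-a+a<a+n = ℕ.≤-trans (ℕ.≤-reflexive (≡.cong suc (ℕ.m+[n∸m]≡n a≤b))) b<a+n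
      others : ∀ i → i < n → i ≢ b ∸ a → 𝟙 (a + i ≡ᵇ b) *R g i ≈ 0#
      others i _ i≢b-a = 𝟙≢-* (λ a+i≡b → i≢b-a (≡.trans (≡.sym (ℕ.m+n∸m≡n a i)) (≡.cong (_∸ a) a+i≡b))) _
  ... | Relation.Nullary.no a≰b =
    trans (∑<-zero n (λ i _ → 𝟙≢-* (λ a+i≡b → a≰b (ℕ.≤-trans (ℕ.m≤m+n a i) (ℕ.≤-reflexive a+i≡b))) _))
          (sym (𝟙>-* (ℕ.≰⇒> a≰b) _))

  ∑^ : {X : Set} → List X → ℕ → (List X → Carrier) → Carrier
  ∑^ xs zero    g = g []
  ∑^ xs (suc m) g = ∑[ t ∈ xs ] ∑^ xs m (λ w → g (t ∷ w))

  syntax ∑^ xs m (λ w → e) = ∑[ w ∈ xs ^ m ] e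

  module _ {X : Set} (xs : List X) where

    ∑^-cong-All : {Q : X → Set} → All Q xs → ∀ m {g h : List X → Carrier} →
                  (∀ w → length w ≡ m → All Q w → g w ≈ h w) → ∑^ xs m g ≈ ∑^ xs m h
    ∑^-cong-All qs zero    e = e [] ≡.refl []
    ∑^-cong-All qs (suc m) e =
      ∑-cong-All xs qs (λ t qt → ∑^-cong-All qs m (λ w |w| qw → e (t ∷ w) (≡.cong suc |w|) (qt ∷ qw)))

    ∑^-cong : ∀ m {g h : List X → Carrier} → (∀ w → length w ≡ m → g w ≈ h w) → ∑^ xs m g ≈ ∑^ xs m h
    ∑^-cong zero    e = e [] ≡.refl
    ∑^-cong (suc m) e = ∑-cong xs (λ t → ∑^-cong m (λ w |w| → e (t ∷ w) (≡.cong suc |w|)))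

    ∑^-zero : ∀ m {g : List X → Carrier} → (∀ w → g w ≈ 0#) → ∑^ xs m g ≈ 0#
    ∑^-zero zero    e = e []
    ∑^-zero (suc m) e = ∑-zero xs (λ t → ∑^-zero m (λ w → e (t ∷ w)))

    ∑^-+ : ∀ m (g h : List X → Carrier) → ∑[ w ∈ xs ^ m ] (g w +R h w) ≈ ∑^ xs m g +R ∑^ xs m h
    ∑^-+ zero    g h = refl
    ∑^-+ (suc m) g h = trans (∑-cong xs (λ t → ∑^-+ m _ _)) (∑-+ xs _ _)

    ∑^-distribˡ : ∀ m (a : Carrier) (g : List X → Carrier) → a *R ∑^ xs m g ≈ ∑[ w ∈ xs ^ m ] a *R g w
    ∑^-distribˡ zero    a g = refl
    ∑^-distribˡ (suc m) a g = trans (∑-distribˡ xs a _) (∑-cong xs (λ t → ∑^-distribˡ m a _))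

    ∑^-distribʳ : ∀ m (a : Carrier) (g : List X → Carrier) → ∑^ xs m g *R a ≈ ∑[ w ∈ xs ^ m ] g w *R a
    ∑^-distribʳ m a g = trans (*-comm _ _) (trans (∑^-distribˡ m a g) (∑^-cong m (λ w _ → *-comm _ _)))

    ∑-∑^-comm : {A : Set} (ys : List A) (m : ℕ) (h : A → List X → Carrier) →
                ∑[ y ∈ ys ] ∑^ xs m (h y) ≈ ∑[ w ∈ xs ^ m ] ∑[ y ∈ ys ] h y w
    ∑-∑^-comm ys zero    h = refl
    ∑-∑^-comm ys (suc m) h = trans (∑-comm ys xs (λ y t → ∑^ xs m (λ w → h y (t ∷ w))))
                                   (∑-cong xs (λ t → ∑-∑^-comm ys m (λ y w → h y (t ∷ w))))

    ∑<-∑^-comm : (n m : ℕ) (h : ℕ → List X → Carrier) →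
                 ∑[ i < n ] ∑^ xs m (h i) ≈ ∑[ w ∈ xs ^ m ] ∑[ i < n ] h i w
    ∑<-∑^-comm zero    m h = sym (∑^-zero m (λ _ → refl))
    ∑<-∑^-comm (suc n) m h = trans (+-congˡ (∑<-∑^-comm n m (h ∘ suc))) (sym (∑^-+ m (h 0) _))

    ∑^-++ : ∀ a b (g : List X → Carrier) → ∑^ xs (a + b) g ≈ ∑[ y ∈ xs ^ a ] ∑[ z ∈ xs ^ b ] g (y ++ z)
    ∑^-++ zero    b g = refl
    ∑^-++ (suc a) b g = ∑-cong xs (λ t → ∑^-++ a b (λ w → g (t ∷ w)))

    ∑^-comm : ∀ a b (h : List X → List X → Carrier) →
              ∑[ y ∈ xs ^ a ] ∑[ z ∈ xs ^ b ] h y z ≈ ∑[ z ∈ xs ^ b ] ∑[ y ∈ xs ^ a ] h y z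
    ∑^-comm zero    b h = refl
    ∑^-comm (suc a) b h = trans (∑-cong xs (λ t → ∑^-comm a b (λ y z → h (t ∷ y) z)))
                                (∑-∑^-comm xs b (λ t z → ∑^ xs a (λ y → h (t ∷ y) z)))

    ∑^-rotate : ∀ m r (ψ : List X → Carrier) → r ≤ m → ∑[ w ∈ xs ^ m ] ψ (rotate r w) ≈ ∑^ xs m ψ
    ∑^-rotate m r ψ r≤m = begin
        ∑[ w ∈ xs ^ m ] ψ (rotate r w)
      ≡⟨ ≡.cong (λ q → ∑[ w ∈ xs ^ q ] ψ (rotate r w)) (≡.sym (ℕ.m+[n∸m]≡n r≤m)) ⟩
        ∑[ w ∈ xs ^ (r + k) ] ψ (rotate r w)
      ≈⟨ ∑^-++ r k _ ⟩
        ∑[ y ∈ xs ^ r ] ∑[ z ∈ xs ^ k ] ψ (rotate r (y ++ z))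
      ≈⟨ ∑^-cong r (λ y |y| → ∑^-cong k (λ z _ → reflexive (≡.cong ψ (rotate-++′ y z |y|)))) ⟩
        ∑[ y ∈ xs ^ r ] ∑[ z ∈ xs ^ k ] ψ (z ++ y)
      ≈⟨ ∑^-comm r k _ ⟩
        ∑[ z ∈ xs ^ k ] ∑[ y ∈ xs ^ r ] ψ (z ++ y)
      ≈⟨ sym (∑^-++ k r ψ) ⟩
        ∑^ xs (k + r) ψ
      ≡⟨ ≡.cong (λ q → ∑^ xs q ψ) (ℕ.m∸n+n≡m r≤m) ⟩
        ∑^ xs m ψ ∎
      where
        k : ℕ
        k = m ∸ r
        rotate-++′ : ∀ y z → length y ≡ r → rotate r (y ++ z) ≡ z ++ y
        rotate-++′ y z ≡.refl = rotate-++ y z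

  ∑^-cartesianProduct : {A B : Set} (xs : List A) (ys : List B) (m : ℕ) (g : List (A × B) → Carrier) →
    ∑^ (cartesianProduct xs ys) m g ≈ ∑[ as ∈ xs ^ m ] ∑[ bs ∈ ys ^ m ] g (zip as bs)
  ∑^-cartesianProduct xs ys zero    g = refl
  ∑^-cartesianProduct xs ys (suc m) g = begin
      ∑[ t ∈ cartesianProduct xs ys ] ∑[ w ∈ cartesianProduct xs ys ^ m ] g (t ∷ w)
    ≈⟨ ∑-cartesianProduct xs ys _ ⟩
      ∑[ a ∈ xs ] ∑[ b ∈ ys ] ∑[ w ∈ cartesianProduct xs ys ^ m ] g ((a , b) ∷ w)
    ≈⟨ ∑-cong xs (λ a → ∑-cong ys (λ b → ∑^-cartesianProduct xs ys m (λ w → g ((a , b) ∷ w)))) ⟩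
      ∑[ a ∈ xs ] ∑[ b ∈ ys ] ∑[ as ∈ xs ^ m ] ∑[ bs ∈ ys ^ m ] g (zip (a ∷ as) (b ∷ bs))
    ≈⟨ ∑-cong xs (λ a → ∑-∑^-comm xs ys m _) ⟩
      ∑[ a ∈ xs ] ∑[ as ∈ xs ^ m ] ∑[ b ∈ ys ] ∑[ bs ∈ ys ^ m ] g (zip (a ∷ as) (b ∷ bs)) ∎

  module _ {X : Set} (c : X → ℕ) where
    open Walk c

    exiting-rotations : ∀ x → ∑[ r < length x ] 𝟙 (exits 0 (rotate r x)) ≈ 𝟙 (endsOneLower x)
    exiting-rotations x with suc (charge x) ℕ.≟ length x
    ... | no ¬total = trans (∑<-zero (length x) (λ r _ → 𝟙-¬T (¬total ∘ exits-rotate⇒endsOneLower r x)))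
                            (sym (𝟙-¬T (¬total ∘ ℕ.≡ᵇ⇒≡ _ _)))
    ... | yes total with exiting-rotation-exists x total
    ...   | r₀ , r₀<|x| , p₀ = trans (∑<-single (length x) r₀ _ r₀<|x| others)
                                     (trans (𝟙-T p₀) (sym (𝟙-T (ℕ.≡⇒≡ᵇ _ _ total))))
      where
        others : ∀ r → r < length x → r ≢ r₀ → 𝟙 (exits 0 (rotate r x)) ≈ 0#
        others r r<|x| r≢r₀ = 𝟙-¬T (λ p → case (ℕ.<-cmp r r₀) p)
          where
            case : Tri (r < r₀) (r ≡ r₀) (r₀ < r) → T (exits 0 (rotate r x)) → ⊥
            case (tri< r<r₀ _ _) p = exiting-rotation-unique x r<r₀ r₀<|x| p p₀
            case (tri≈ _ r≡r₀ _) p = r≢r₀ r≡r₀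
            case (tri> _ _ r₀<r) p = exiting-rotation-unique x r₀<r r<|x| p₀ p

    cycle-lemma : (xs : List X) (m : ℕ) (φ : List X → Carrier) → (∀ y z → φ (y ++ z) ≈ φ (z ++ y)) →
                  ∑[ w ∈ xs ^ m ] 𝟙 (endsOneLower w) *R φ w ≈ fromℕ R m *R (∑[ w ∈ xs ^ m ] 𝟙 (exits 0 w) *R φ w)
    cycle-lemma xs m φ φ-rotate = begin
        ∑[ w ∈ xs ^ m ] 𝟙 (endsOneLower w) *R φ w
      ≈⟨ ∑^-cong xs m (λ w |w| → *-congʳ (sym (≡.subst (λ q → ∑[ r < q ] 𝟙 (exits 0 (rotate r w)) ≈ _) |w| (exiting-rotations w)))) ⟩
        ∑[ w ∈ xs ^ m ] (∑[ r < m ] 𝟙 (exits 0 (rotate r w))) *R φ w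
      ≈⟨ ∑^-cong xs m (λ w _ → trans (*-comm _ _) (∑<-distribˡ m (φ w) _)) ⟩
        ∑[ w ∈ xs ^ m ] ∑[ r < m ] φ w *R 𝟙 (exits 0 (rotate r w))
      ≈⟨ sym (∑<-∑^-comm xs m m _) ⟩
        ∑[ r < m ] ∑[ w ∈ xs ^ m ] φ w *R 𝟙 (exits 0 (rotate r w))
      ≈⟨ ∑<-cong m (λ r r<m → trans (∑^-cong xs m (λ w _ → trans (*-comm _ _) (*-congˡ (φ-rotate′ r w))))
                                     (∑^-rotate xs m r ψ (ℕ.<⇒≤ r<m))) ⟩
        ∑[ r < m ] ∑^ xs m ψ
      ≈⟨ ∑<-const m _ ⟩
        fromℕ R m *R ∑^ xs m ψ ∎
      where
        ψ : List X → Carrier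
        ψ w = 𝟙 (exits 0 w) *R φ w
        φ-rotate′ : ∀ r w → φ w ≈ φ (rotate r w)
        φ-rotate′ r w = trans (reflexive (≡.cong φ (≡.sym (List.take++drop≡id r w)))) (φ-rotate (take r w) (drop r w))

  -- `generates` says that a g is the total weight of the letters of degree g, and that no
  -- letter has degree above D.
  module PowerCoefficient {Y : Set} (ys : List Y) (deg : Y → ℕ) (ω : Y → Carrier) (a : PS R) (D : ℕ)
    (generates : ∀ (φ : ℕ → Carrier) → ∑[ y ∈ ys ] ω y *R φ (deg y) ≈ ∑[ g < suc D ] a g *R φ g) where

    degree : List Y → ℕ
    degree w = sum (map deg w)

    coefficient-power : ∀ m H → H ≤ D → ∑[ w ∈ ys ^ m ] 𝟙 (degree w ≡ᵇ H) *R Πl R (map ω w) ≈ (_^PS_ R a m) H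
    coefficient-power zero zero    _ = *-identityˡ _
    coefficient-power zero (suc H) _ = zeroˡ _
    coefficient-power (suc m) H H≤D = begin
        ∑[ y ∈ ys ] ∑[ w ∈ ys ^ m ] 𝟙 (deg y + degree w ≡ᵇ H) *R (ω y *R Πl R (map ω w))
      ≈⟨ ∑-cong ys (λ y → trans (∑^-cong ys m (λ w _ → x∙yz≈y∙xz _ _ _)) (sym (∑^-distribˡ ys m (ω y) _))) ⟩
        ∑[ y ∈ ys ] ω y *R Ψ (deg y)
      ≈⟨ generates Ψ ⟩
        ∑[ g < suc D ] a g *R Ψ g
      ≈⟨ ∑<-truncate (suc H) (suc D) _ (s≤s H≤D) (λ g H<g _ → trans (*-congˡ (Ψ-zero g H<g)) (zeroʳ (a g))) ⟩
        ∑[ g < suc H ] a g *R Ψ g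
      ≈⟨ ∑<-cong (suc H) (λ g g<1+H → *-congˡ {a g} (Ψ-power g (ℕ.≤-pred g<1+H))) ⟩
        ∑[ g < suc H ] a g *R (_^PS_ R a m) (H ∸ g)
      ≡⟨ ≡.sym (∑-upTo (suc H) _) ⟩
        (_^PS_ R a (suc m)) H ∎
      where
        Ψ : ℕ → Carrier
        Ψ g = ∑[ w ∈ ys ^ m ] 𝟙 (g + degree w ≡ᵇ H) *R Πl R (map ω w)
        Ψ-zero : ∀ g → H < g → Ψ g ≈ 0#
        Ψ-zero g H<g = ∑^-zero ys m (λ w → 𝟙≢-* (λ e → ℕ.<-irrefl (≡.sym e) (ℕ.<-≤-trans H<g (ℕ.m≤m+n g _))) _)
        Ψ-power : ∀ g → g ≤ H → Ψ g ≈ (_^PS_ R a m) (H ∸ g)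
        Ψ-power g g≤H = trans (∑^-cong ys m (λ w _ → *-congʳ (trans (reflexive (≡.cong 𝟙 (+≡ᵇ-split g (degree w) H)))
                                                                     (trans (𝟙-∧ (g ≤ᵇ H) _) (𝟙≤-* g≤H _)))))
                              (coefficient-power m (H ∸ g) (ℕ.≤-trans (ℕ.m∸n≤m H g) H≤D))

  onePlusX : PS R
  onePlusX zero          = 1#
  onePlusX (suc zero)    = 1#
  onePlusX (suc (suc _)) = 0#

  onePlusX-power : ∀ m j → (_^PS_ R onePlusX m) j ≈ fromℕ R (m C j)
  onePlusX-power zero    zero    = sym (+-identityʳ _)
  onePlusX-power zero    (suc j) = refl
  onePlusX-power (suc m) zero    = trans (+-identityʳ _) (trans (*-identityˡ _) (onePlusX-power m 0))
  onePlusX-power (suc m) (suc j) = begin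
      (_^PS_ R onePlusX (suc m)) (suc j)
    ≡⟨ ∑-upTo (suc (suc j)) _ ⟩
      1# *R P (suc j) +R (1# *R P j +R (∑[ g < j ] 0# *R P (j ∸ suc g)))
    ≈⟨ +-cong (*-identityˡ _) (trans (+-cong (*-identityˡ _) (∑<-zero j (λ g _ → zeroˡ _))) (+-identityʳ _)) ⟩
      P (suc j) +R P j
    ≈⟨ +-cong (onePlusX-power m (suc j)) (onePlusX-power m j) ⟩
      fromℕ R (m C suc j) +R fromℕ R (m C j)
    ≈⟨ trans (+-comm _ _) (sym (fromℕ-+ (m C j) (m C suc j))) ⟩
      fromℕ R (m C j + m C suc j)
    ≡⟨ ≡.cong (fromℕ R) (nCk+nC[k+1]≡[n+1]C[k+1] m j) ⟩
      fromℕ R (suc m C suc j) ∎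
    where
      P : PS R
      P = _^PS_ R onePlusX m

  -- Paths as sequences of units

  module SingleUStep (f : ℕ → Carrier) (r s : ℕ) (Bs : List Step) where

    u : Step
    u = step (suc r) (up s) true

    F : ℕ → Carrier
    F = Fser R f

    -- the weight of a word read from height h that continues a block of k 𝒰-steps
    weight : ℕ → ℕ → List Step → Carrier
    weight h k P = 𝟙 (valid h P) *R Πl R (map f (ublocksFrom k P))

    pathSumFrom : ℕ → ℕ → ℕ → Carrier
    pathSumFrom h k n = ∑ (words n (u ∷ Bs) n) (weight h k)

    weightAfter : Move → ℕ → List Step → Carrier
    weightAfter (up t) h      P = weight (h + t) 0 P
    weightAfter down   zero    P = 0#
    weightAfter down   (suc h) P = weight h 0 P

    pathSumAfter : Move → ℕ → ℕ → Carrier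
    pathSumAfter mv h n = ∑ (words n (u ∷ Bs) n) (weightAfter mv h)

    -- paths that are empty or start with a step of Bs, closing the current block of k 𝒰-steps
    pathSumClosing : ℕ → ℕ → ℕ → Carrier
    pathSumClosing h k zero    = 𝟙 (h ≡ᵇ 0) *R F k
    pathSumClosing h k (suc n) = ∑[ b ∈ Bs ] 𝟙 (len b ≤ᵇ suc n) *R (F k *R pathSumAfter (move b) h (suc n ∸ len b))

    pathSumClosing-cong : ∀ {h h′ k k′ n n′} → h ≡ h′ → k ≡ k′ → n ≡ n′ → pathSumClosing h k n ≡ pathSumClosing h′ k′ n′
    pathSumClosing-cong ≡.refl ≡.refl ≡.refl = ≡.refl

    weight-u : ∀ h k P → weight h k (u ∷ P) ≡ weight (h + s) (suc k) P
    weight-u h zero    P = ≡.refl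
    weight-u h (suc k) P = ≡.refl

    weight-nonU : ∀ h k l mv P → weight h k (step l mv false ∷ P) ≈ F k *R weightAfter mv h P
    weight-nonU h       k l (up t) P = trans (*-congˡ (blocks-closed k)) (x∙yz≈y∙xz _ _ _)
      where
        blocks-closed : ∀ k → Πl R (map f (ublocksFrom k (step l (up t) false ∷ P))) ≈ F k *R Πl R (map f (ublocks P))
        blocks-closed zero    = sym (*-identityˡ _)
        blocks-closed (suc k) = refl
    weight-nonU zero    k l down P = trans (zeroˡ _) (sym (zeroʳ _))
    weight-nonU (suc h) k l down P = trans (*-congˡ (blocks-closed k)) (x∙yz≈y∙xz _ _ _)
      where
        blocks-closed : ∀ k → Πl R (map f (ublocksFrom k (step l down false ∷ P))) ≈ F k *R Πl R (map f (ublocks P))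
        blocks-closed zero    = sym (*-identityˡ _)
        blocks-closed (suc k) = refl

    pathSumFrom-firstStep : All IsNonU Bs → ∀ h k n →
      pathSumFrom h k n ≈ 𝟙 (suc r ≤ᵇ n) *R pathSumFrom (h + s) (suc k) (n ∸ suc r) +R pathSumClosing h k n
    pathSumFrom-firstStep _ h k zero = begin
        weight h k [] +R 0#                           ≈⟨ +-identityʳ _ ⟩
        𝟙 (h ≡ᵇ 0) *R Πl R (map f (ublocksFrom k [])) ≈⟨ *-congˡ (empty-block k) ⟩
        𝟙 (h ≡ᵇ 0) *R F k                             ≈⟨ sym (+-identityˡ _) ⟩
        0# +R 𝟙 (h ≡ᵇ 0) *R F k                       ≈⟨ +-congʳ (sym (zeroˡ _)) ⟩
        0# *R pathSumFrom (h + s) (suc k) 0 +R 𝟙 (h ≡ᵇ 0) *R F k ∎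
      where
        empty-block : ∀ k → Πl R (map f (ublocksFrom k [])) ≈ F k
        empty-block zero    = refl
        empty-block (suc k) = *-identityʳ _
    pathSumFrom-firstStep nonU h k (suc n) =
      trans (∑-concatMap (u ∷ Bs) firstStep (weight h k)) (+-cong u-first (∑-cong-All Bs nonU b-first))
      where
        W : ℕ → List (List Step)
        W m = words n (u ∷ Bs) m
        firstStep : Step → List (List Step)
        firstStep a = if len a ≡ᵇ 0 then [] else if len a ≤ᵇ suc n then map (a ∷_) (W (suc n ∸ len a)) else []
        refuel : ∀ m → m ≤ n → W m ≡ words m (u ∷ Bs) m
        refuel m m≤n = words-fuel (u ∷ Bs) m m≤n ℕ.≤-refl
        u-first : ∑ (firstStep u) (weight h k) ≈ 𝟙 (suc r ≤ᵇ suc n) *R pathSumFrom (h + s) (suc k) (suc n ∸ suc r)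
        u-first with suc r ≤ᵇ suc n
        ... | false = sym (zeroˡ _)
        ... | true  = begin
            ∑ (map (u ∷_) (W (n ∸ r))) (weight h k)          ≡⟨ ∑-map (W (n ∸ r)) (u ∷_) (weight h k) ⟩
            ∑[ P ∈ W (n ∸ r) ] weight h k (u ∷ P)             ≈⟨ ∑-cong (W (n ∸ r)) (reflexive ∘ weight-u h k) ⟩
            ∑ (W (n ∸ r)) (weight (h + s) (suc k))
              ≡⟨ ≡.cong (λ ws → ∑ ws (weight (h + s) (suc k))) (refuel (n ∸ r) (ℕ.m∸n≤m n r)) ⟩
            pathSumFrom (h + s) (suc k) (n ∸ r)               ≈⟨ sym (*-identityˡ _) ⟩
            1# *R pathSumFrom (h + s) (suc k) (n ∸ r)         ∎
        b-first : ∀ b → IsNonU b → ∑ (firstStep b) (weight h k) ≈ 𝟙 (len b ≤ᵇ suc n) *R (F k *R pathSumAfter (move b) h (suc n ∸ len b))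
        b-first (step (suc l) mv false) (≡.refl , s≤s _) with suc l ≤ᵇ suc n
        ... | false = sym (zeroˡ _)
        ... | true  = begin
            ∑ (map (b ∷_) (W (n ∸ l))) (weight h k)          ≡⟨ ∑-map (W (n ∸ l)) (b ∷_) (weight h k) ⟩
            ∑[ P ∈ W (n ∸ l) ] weight h k (b ∷ P)             ≈⟨ ∑-cong (W (n ∸ l)) (weight-nonU h k (suc l) mv) ⟩
            ∑[ P ∈ W (n ∸ l) ] F k *R weightAfter mv h P      ≈⟨ sym (∑-distribˡ (W (n ∸ l)) (F k) _) ⟩
            F k *R ∑ (W (n ∸ l)) (weightAfter mv h)
              ≡⟨ ≡.cong (λ ws → F k *R ∑ ws (weightAfter mv h)) (refuel (n ∸ l) (ℕ.m∸n≤m n l)) ⟩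
            F k *R pathSumAfter mv h (n ∸ l)                  ≈⟨ sym (*-identityˡ _) ⟩
            1# *R (F k *R pathSumAfter mv h (n ∸ l))          ∎
          where b = step (suc l) mv false

    pathSumFrom-unfold : All IsNonU Bs → ∀ L n h k → n ≤ L →
      pathSumFrom h k n ≈ ∑[ l < suc L ] 𝟙 (l * suc r ≤ᵇ n) *R pathSumClosing (h + l * s) (k + l) (n ∸ l * suc r)
    pathSumFrom-unfold nonU L n h k n≤L = begin
        pathSumFrom h k n
      ≈⟨ pathSumFrom-firstStep nonU h k n ⟩
        𝟙 (suc r ≤ᵇ n) *R pathSumFrom (h + s) (suc k) (n ∸ suc r) +R pathSumClosing h k n
      ≈⟨ +-comm _ _ ⟩
        pathSumClosing h k n +R 𝟙 (suc r ≤ᵇ n) *R pathSumFrom (h + s) (suc k) (n ∸ suc r)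
      ≈⟨ +-cong (sym (trans (*-identityˡ _) (reflexive (pathSumClosing-cong (ℕ.+-identityʳ h) (ℕ.+-identityʳ k) (≡.refl {x = n})))))
                (longer L n≤L) ⟩
        ∑[ l < suc L ] term l ∎
      where
        term : ℕ → Carrier
        term l = 𝟙 (l * suc r ≤ᵇ n) *R pathSumClosing (h + l * s) (k + l) (n ∸ l * suc r)
        longer : ∀ L → n ≤ L → 𝟙 (suc r ≤ᵇ n) *R pathSumFrom (h + s) (suc k) (n ∸ suc r) ≈ ∑[ l < L ] term (suc l)
        longer zero    z≤n = zeroˡ _
        longer (suc L) n≤1+L with suc r ℕ.≤? n
        ... | no ru≰n = trans (𝟙>-* (ℕ.≰⇒> ru≰n) _)
                              (sym (∑<-zero (suc L) {term ∘ suc}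
                                     (λ l _ → 𝟙>-* (ℕ.<-≤-trans (ℕ.≰⇒> ru≰n) (ℕ.m≤m+n (suc r) (l * suc r))) _)))
        ... | yes ru≤n = begin
            𝟙 (suc r ≤ᵇ n) *R pathSumFrom (h + s) (suc k) (n ∸ suc r)
          ≈⟨ 𝟙≤-* ru≤n _ ⟩
            pathSumFrom (h + s) (suc k) (n ∸ suc r)
          ≈⟨ pathSumFrom-unfold nonU L (n ∸ suc r) (h + s) (suc k) (ℕ.≤-pred (ℕ.≤-trans (ℕ.∸-monoʳ-< (s≤s z≤n) ru≤n) n≤1+L)) ⟩
            ∑[ l < suc L ] 𝟙 (l * suc r ≤ᵇ n ∸ suc r) *R pathSumClosing (h + s + l * s) (suc k + l) (n ∸ suc r ∸ l * suc r)
          ≈⟨ ∑<-cong (suc L) (λ l _ → reflexive (reindex l)) ⟩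
            ∑[ l < suc L ] term (suc l) ∎
          where
            reindex : ∀ l → 𝟙 (l * suc r ≤ᵇ n ∸ suc r) *R pathSumClosing (h + s + l * s) (suc k + l) (n ∸ suc r ∸ l * suc r)
                            ≡ term (suc l)
            reindex l = ≡.cong₂ (λ b x → 𝟙 b *R x) (≤ᵇ-∸ (l * suc r) ru≤n)
                          (pathSumClosing-cong (shuffle l s h) (≡.sym (ℕ.+-suc k l)) (ℕ.∸-+-assoc n (suc r) (l * suc r)))
              where
                shuffle : ∀ l s h → h + s + l * s ≡ h + (s + l * s)
                shuffle = solve-∀

  -- A unit (l , b) stands for the word uˡ b: a block of l 𝒰-steps closed by the step b.
  module Units (f : ℕ → Carrier) (r s : ℕ) (Bs : List Step) (B : ℕ) where
    open SingleUStep f r s Bs public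

    Unit : Set
    Unit = ℕ × Step

    units : List Unit
    units = cartesianProduct (upTo (suc B)) Bs

    unitCharge : Unit → ℕ
    unitCharge (l , b) = l * s + moveCharge (move b)

    unitLength : Unit → ℕ
    unitLength (l , b) = l * suc r + len b

    totalLength : List Unit → ℕ
    totalLength x = sum (map unitLength x)

    unitWeight : List Unit → Carrier
    unitWeight x = Πl R (map (F ∘ proj₁) x)

    open Walk unitCharge public

    weightOfLength : ℕ → List Unit → Carrier
    weightOfLength N x = 𝟙 (totalLength x ≡ᵇ N) *R unitWeight x

    weightOfLength-rotate : ∀ N y z → weightOfLength N (y ++ z) ≈ weightOfLength N (z ++ y)
    weightOfLength-rotate N y z = *-cong (reflexive (≡.cong (λ L → 𝟙 (L ≡ᵇ N)) (totalLength-swap y z))) (unitWeight-swap y z)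
      where
        totalLength-++ : ∀ y z → totalLength (y ++ z) ≡ totalLength y + totalLength z
        totalLength-++ y z = ≡.trans (≡.cong sum (List.map-++ unitLength y z)) (sum-++ (map unitLength y) (map unitLength z))
        totalLength-swap : ∀ y z → totalLength (y ++ z) ≡ totalLength (z ++ y)
        totalLength-swap y z = ≡.trans (totalLength-++ y z) (≡.trans (ℕ.+-comm (totalLength y) _) (≡.sym (totalLength-++ z y)))
        unitWeight-++ : ∀ y z → unitWeight (y ++ z) ≈ unitWeight y *R unitWeight z
        unitWeight-++ y z = trans (reflexive (≡.cong (Πl R) (List.map-++ (F ∘ proj₁) y z))) (Πl-++ (map (F ∘ proj₁) y) (map (F ∘ proj₁) z))
        unitWeight-swap : ∀ y z → unitWeight (y ++ z) ≈ unitWeight (z ++ y)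
        unitWeight-swap y z = trans (unitWeight-++ y z) (trans (*-comm _ _) (sym (unitWeight-++ z y)))

    -- exitSum⁺ M k L N continues exitSum M h N after a first unit of length L that leaves the
    -- walk at height k - 1.
    exitSum : ℕ → ℕ → ℕ → Carrier
    exitSum M h N = ∑[ m < M ] ∑[ x ∈ units ^ m ] 𝟙 (exits h x) *R weightOfLength N x

    exitSum⁺ : ℕ → ℕ → ℕ → ℕ → Carrier
    exitSum⁺ M k L N = ∑[ m < M ] ∑[ x ∈ units ^ m ] 𝟙 (exits⁺ k x) *R (𝟙 (L + totalLength x ≡ᵇ N) *R unitWeight x)

    ∑-units : (g : Unit → Carrier) → ∑ units g ≈ ∑[ l < suc B ] ∑[ b ∈ Bs ] g (l , b)
    ∑-units g = trans (∑-cartesianProduct (upTo (suc B)) Bs g) (reflexive (∑-upTo (suc B) _))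

    exitSum-firstUnit : ∀ M h N →
      exitSum (suc M) h N ≈ ∑[ l < suc B ] ∑[ b ∈ Bs ] F l *R exitSum⁺ M (h + unitCharge (l , b)) (unitLength (l , b)) N
    exitSum-firstUnit M h N = begin
        exitSum (suc M) h N
      ≈⟨ trans (+-congʳ (zeroˡ _)) (+-identityˡ _) ⟩
        ∑[ m < M ] ∑[ t ∈ units ] ∑[ x ∈ units ^ m ] 𝟙 (exits h (t ∷ x)) *R (𝟙 (totalLength (t ∷ x) ≡ᵇ N) *R unitWeight (t ∷ x))
      ≈⟨ sym (∑-∑<-comm units M _) ⟩
        ∑[ t ∈ units ] ∑[ m < M ] ∑[ x ∈ units ^ m ] 𝟙 (exits h (t ∷ x)) *R (𝟙 (totalLength (t ∷ x) ≡ᵇ N) *R unitWeight (t ∷ x))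
      ≈⟨ ∑-cong units (λ t → trans (∑<-cong M (λ m _ → trans (∑^-cong units m (λ x _ → pull-F t x)) (sym (∑^-distribˡ units m _ _))))
                                    (sym (∑<-distribˡ M _ _))) ⟩
        ∑[ t ∈ units ] F (proj₁ t) *R exitSum⁺ M (h + unitCharge t) (unitLength t) N
      ≈⟨ ∑-units _ ⟩
        ∑[ l < suc B ] ∑[ b ∈ Bs ] F l *R exitSum⁺ M (h + unitCharge (l , b)) (unitLength (l , b)) N ∎
      where
        pull-F : ∀ t x → 𝟙 (exits h (t ∷ x)) *R (𝟙 (totalLength (t ∷ x) ≡ᵇ N) *R unitWeight (t ∷ x))
                         ≈ F (proj₁ t) *R (𝟙 (exits⁺ (h + unitCharge t) x) *R (𝟙 (unitLength t + totalLength x ≡ᵇ N) *R unitWeight x))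
        pull-F t x = trans (*-congˡ (x∙yz≈y∙xz _ _ _)) (x∙yz≈y∙xz _ _ _)

    exitSum⁺-exit : ∀ M L N → exitSum⁺ (suc M) 0 L N ≈ 𝟙 (L ≡ᵇ N)
    exitSum⁺-exit M L N = begin
        exitSum⁺ (suc M) 0 L N
      ≈⟨ +-cong (trans (*-identityˡ _) (*-identityʳ _)) (∑<-zero M (λ m _ → ∑-zero units (λ t → ∑^-zero units m (λ x → zeroˡ _)))) ⟩
        𝟙 (L + 0 ≡ᵇ N) +R 0#
      ≈⟨ trans (+-identityʳ _) (reflexive (≡.cong (λ L → 𝟙 (L ≡ᵇ N)) (ℕ.+-identityʳ L))) ⟩
        𝟙 (L ≡ᵇ N) ∎

    exitSum⁺-exit-≢ : ∀ M {L N} → L ≢ N → exitSum⁺ M 0 L N ≈ 0#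
    exitSum⁺-exit-≢ zero    L≢N = refl
    exitSum⁺-exit-≢ (suc M) {L} {N} L≢N = trans (exitSum⁺-exit M L N) (𝟙-¬T (L≢N ∘ ℕ.≡ᵇ⇒≡ L N))

    exitSum⁺-continue : ∀ M k L N → exitSum⁺ M (suc k) L N ≈ 𝟙 (L ≤ᵇ N) *R exitSum M k (N ∸ L)
    exitSum⁺-continue M k L N = begin
        exitSum⁺ M (suc k) L N
      ≈⟨ ∑<-cong M (λ m _ → ∑^-cong units m (λ x _ → split-length x)) ⟩
        ∑[ m < M ] ∑[ x ∈ units ^ m ] 𝟙 (L ≤ᵇ N) *R (𝟙 (exits k x) *R (𝟙 (totalLength x ≡ᵇ N ∸ L) *R unitWeight x))
      ≈⟨ sym (trans (∑<-distribˡ M _ _) (∑<-cong M (λ m _ → ∑^-distribˡ units m _ _))) ⟩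
        𝟙 (L ≤ᵇ N) *R exitSum M k (N ∸ L) ∎
      where
        split-length : ∀ x → 𝟙 (exits k x) *R (𝟙 (L + totalLength x ≡ᵇ N) *R unitWeight x)
                             ≈ 𝟙 (L ≤ᵇ N) *R (𝟙 (exits k x) *R (𝟙 (totalLength x ≡ᵇ N ∸ L) *R unitWeight x))
        split-length x = begin
            𝟙 (exits k x) *R (𝟙 (L + totalLength x ≡ᵇ N) *R unitWeight x)
          ≡⟨ ≡.cong (λ b → 𝟙 (exits k x) *R (𝟙 b *R unitWeight x)) (+≡ᵇ-split L (totalLength x) N) ⟩
            𝟙 (exits k x) *R (𝟙 ((L ≤ᵇ N) ∧ (totalLength x ≡ᵇ N ∸ L)) *R unitWeight x)
          ≈⟨ *-congˡ (trans (*-congʳ (𝟙-∧ (L ≤ᵇ N) _)) (*-assoc _ _ _)) ⟩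
            𝟙 (exits k x) *R (𝟙 (L ≤ᵇ N) *R (𝟙 (totalLength x ≡ᵇ N ∸ L) *R unitWeight x))
          ≈⟨ x∙yz≈y∙xz _ _ _ ⟩
            𝟙 (L ≤ᵇ N) *R (𝟙 (exits k x) *R (𝟙 (totalLength x ≡ᵇ N ∸ L) *R unitWeight x)) ∎

    exit⇒down : ∀ h l b → h + unitCharge (l , b) ≡ 0 → move b ≡ down
    exit⇒down h l b k≡0 = moveCharge≡0⇒down (ℕ.m+n≡0⇒n≡0 (l * s) (ℕ.m+n≡0⇒n≡0 h k≡0))

    module _ {w : ℕ} (w>0 : 0 < w) (nonU : All (NonUStep w) Bs) where

      mutual
        exitSum-short : ∀ M h N → N < w → exitSum M h N ≈ 0#
        exitSum-short zero    h N N<w = refl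
        exitSum-short (suc M) h N N<w =
          trans (exitSum-firstUnit M h N)
                (∑<-zero (suc B) (λ l _ → ∑-zero-All Bs nonU (λ b b-ok →
                   trans (*-congˡ (exitSum⁺-vanish M _ (unitLength (l , b)) N (no-exit l b b-ok) (ℕ.≤-<-trans (ℕ.m∸n≤m N (unitLength (l , b))) N<w)))
                         (zeroʳ (F l)))))
          where
            no-exit : ∀ l b → NonUStep w b → h + unitCharge (l , b) ≡ 0 → unitLength (l , b) ≢ N
            no-exit l b (_ , down⇒w) k≡0 L≡N = ℕ.<⇒≱ N<w
              (ℕ.≤-trans (ℕ.≤-reflexive (≡.sym (down⇒w (exit⇒down h l b k≡0))))
                         (ℕ.≤-trans (ℕ.m≤n+m (len b) (l * suc r)) (ℕ.≤-reflexive L≡N)))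

        exitSum⁺-vanish : ∀ M k L N → (k ≡ 0 → L ≢ N) → N ∸ L < w → exitSum⁺ M k L N ≈ 0#
        exitSum⁺-vanish M zero    L N no-exit _     = exitSum⁺-exit-≢ M (no-exit ≡.refl)
        exitSum⁺-vanish M (suc k) L N _       short =
          trans (exitSum⁺-continue M k L N) (trans (*-congˡ (exitSum-short M k (N ∸ L) short)) (zeroʳ _))

      exitSum⁺-atEnd : ∀ {M} → 0 < M → ∀ k N → exitSum⁺ M k N N ≈ 𝟙 (k ≡ᵇ 0)
      exitSum⁺-atEnd {suc M} _ zero    N = trans (exitSum⁺-exit M N N) (𝟙-T (ℕ.≡⇒≡ᵇ N N ≡.refl))
      exitSum⁺-atEnd {suc M} _ (suc k) N =
        exitSum⁺-vanish (suc M) (suc k) N N (λ ()) (≡.subst (_< w) (≡.sym (ℕ.n∸n≡0 N)) w>0)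

      module _ (oneDown : length (filterᵇ isDown Bs) ≡ 1) where

        -- n + w is the length of the path followed by the down step.
        PathsAsUnits : ℕ → Set ℓ
        PathsAsUnits n = ∀ h M → n ≤ B → n + w < M → pathSumFrom h 0 n ≈ exitSum M h (n + w)

        module FirstUnit (n : ℕ) (IH : ∀ {n₀} → n₀ < n → PathsAsUnits n₀) (n≤B : n ≤ B)
                         (h M : ℕ) (N<1+M : n + w < suc M) where

          N : ℕ
          N = n + w

          H : ℕ → ℕ
          H l = h + l * s

          firstUnitSum : ℕ → Carrier
          firstUnitSum l = ∑[ b ∈ Bs ] F l *R exitSum⁺ M (h + unitCharge (l , b)) (unitLength (l , b)) N

          firstUnitSum-byMove : ∀ l → firstUnitSum l ≈ ∑[ b ∈ Bs ] F l *R exitSum⁺ M (moveCharge (move b) + H l) (l * suc r + len b) N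
          firstUnitSum-byMove l = ∑-cong Bs (λ b → reflexive (≡.cong (λ k → F l *R exitSum⁺ M k (l * suc r + len b) N) (regroup h (l * s) _)))
            where
              regroup : ∀ h a m → h + (a + m) ≡ m + (h + a)
              regroup = solve-∀

          firstUnit-tooLong : ∀ l → n < l * suc r → firstUnitSum l ≈ 0#
          firstUnit-tooLong l n<a = ∑-zero-All Bs nonU (λ b (_ , down⇒w) →
              trans (*-congˡ (exitSum⁺-vanish M _ (unitLength (l , b)) N (no-exit b down⇒w) (+∸-< w>0 n _ (ℕ.<-≤-trans n<a (ℕ.m≤m+n _ (len b))))))
                    (zeroʳ (F l)))
            where
              no-exit : ∀ b → (move b ≡ down → len b ≡ w) → h + unitCharge (l , b) ≡ 0 → unitLength (l , b) ≢ N
              no-exit b down⇒w k≡0 L≡N = ℕ.<-irrefl (≡.sym (ℕ.+-cancelʳ-≡ w (l * suc r) n L≡N′)) n<a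
                where
                  L≡N′ : l * suc r + w ≡ n + w
                  L≡N′ = ≡.trans (≡.cong (l * suc r +_) (≡.sym (down⇒w (exit⇒down h l b k≡0)))) L≡N

          M>0 : 0 < M
          M>0 = ℕ.<-≤-trans (ℕ.<-≤-trans w>0 (ℕ.m≤n+m w n)) (ℕ.≤-pred N<1+M)

          firstUnit-exact : ∀ l → l * suc r ≡ n → firstUnitSum l ≈ 𝟙 (H l ≡ᵇ 0) *R F l
          firstUnit-exact l a≡n = begin
              firstUnitSum l
            ≈⟨ firstUnitSum-byMove l ⟩
              ∑[ b ∈ Bs ] F l *R exitSum⁺ M (moveCharge (move b) + H l) (l * suc r + len b) N
            ≈⟨ ∑-cong-All Bs nonU onlyDownExits ⟩
              ∑[ b ∈ Bs ] 𝟙 (isDown b) *R (𝟙 (H l ≡ᵇ 0) *R F l)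
            ≈⟨ sym (∑-distribʳ Bs _ _) ⟩
              (∑[ b ∈ Bs ] 𝟙 (isDown b)) *R (𝟙 (H l ≡ᵇ 0) *R F l)
            ≈⟨ *-congʳ (trans (∑-𝟙 isDown Bs) (reflexive (≡.cong (fromℕ R) oneDown))) ⟩
              (1# +R 0#) *R (𝟙 (H l ≡ᵇ 0) *R F l)
            ≈⟨ trans (*-congʳ (+-identityʳ _)) (*-identityˡ _) ⟩
              𝟙 (H l ≡ᵇ 0) *R F l ∎
            where
              onlyDownExits : ∀ b → NonUStep w b →
                F l *R exitSum⁺ M (moveCharge (move b) + H l) (l * suc r + len b) N ≈ 𝟙 (isDown b) *R (𝟙 (H l ≡ᵇ 0) *R F l)
              onlyDownExits (step lb (up t) _) ((_ , lb≥1) , _) =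
                trans (*-congˡ (exitSum⁺-vanish M (suc (t + H l)) (l * suc r + lb) N (λ ()) (+∸-< w>0 n _ n<L)))
                      (trans (zeroʳ _) (sym (zeroˡ _)))
                where
                  n<L : n < l * suc r + lb
                  n<L = ℕ.<-≤-trans (ℕ.n<1+n n) (ℕ.≤-trans (ℕ.≤-reflexive (≡.trans (ℕ.+-comm 1 n) (≡.cong (_+ 1) (≡.sym a≡n))))
                                                        (ℕ.+-monoʳ-≤ (l * suc r) lb≥1))
              onlyDownExits (step lb down _) (_ , down⇒w) = begin
                  F l *R exitSum⁺ M (H l) (l * suc r + lb) N
                    ≡⟨ ≡.cong (λ L → F l *R exitSum⁺ M (H l) L N) (≡.cong₂ _+_ a≡n (down⇒w ≡.refl)) ⟩
                  F l *R exitSum⁺ M (H l) N N                 ≈⟨ *-congˡ (exitSum⁺-atEnd M>0 (H l) N) ⟩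
                  F l *R 𝟙 (H l ≡ᵇ 0)                         ≈⟨ trans (*-comm _ _) (sym (*-identityˡ _)) ⟩
                  1# *R (𝟙 (H l ≡ᵇ 0) *R F l)                 ∎

          module Remaining (l n′ : ℕ) (a+n′≡n : l * suc r + suc n′ ≡ n) where

            a : ℕ
            a = l * suc r

            continues : ∀ H′ lb → 1 ≤ lb →
              𝟙 (lb ≤ᵇ suc n′) *R (F l *R pathSumFrom H′ 0 (suc n′ ∸ lb)) ≈ F l *R exitSum⁺ M (suc H′) (a + lb) N
            continues H′ lb lb≥1 with lb ℕ.≤? suc n′
            ... | no lb≰ = trans (𝟙>-* (ℕ.≰⇒> lb≰) _)
                                 (sym (trans (*-congˡ (exitSum⁺-vanish M (suc H′) (a + lb) N (λ ()) (+∸-< w>0 n _ n<a+lb))) (zeroʳ _)))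
              where
                n<a+lb : n < a + lb
                n<a+lb = ℕ.≤-trans (ℕ.≤-reflexive (≡.trans (≡.cong suc (≡.sym a+n′≡n)) (≡.sym (ℕ.+-suc a (suc n′)))))
                                   (ℕ.+-monoʳ-≤ a (ℕ.≰⇒> lb≰))
            ... | yes lb≤ = begin
                𝟙 (lb ≤ᵇ suc n′) *R (F l *R pathSumFrom H′ 0 m)   ≈⟨ 𝟙≤-* lb≤ _ ⟩
                F l *R pathSumFrom H′ 0 m                          ≈⟨ *-congˡ (IH m<n H′ M (ℕ.≤-trans (ℕ.<⇒≤ m<n) n≤B) m+w<M) ⟩
                F l *R exitSum M H′ (m + w)                        ≡⟨ ≡.cong (λ q → F l *R exitSum M H′ q) (≡.sym N-a-lb) ⟩
                F l *R exitSum M H′ (N ∸ (a + lb))                 ≈⟨ *-congˡ (sym (𝟙≤-* a+lb≤N _)) ⟩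
                F l *R (𝟙 (a + lb ≤ᵇ N) *R exitSum M H′ (N ∸ (a + lb))) ≈⟨ *-congˡ (sym (exitSum⁺-continue M H′ (a + lb) N)) ⟩
                F l *R exitSum⁺ M (suc H′) (a + lb) N              ∎
              where
                m : ℕ
                m = suc n′ ∸ lb
                n′<n : suc n′ ≤ n
                n′<n = ℕ.≤-trans (ℕ.m≤n+m (suc n′) a) (ℕ.≤-reflexive a+n′≡n)
                m<n : m < n
                m<n = ℕ.<-≤-trans (s≤s (ℕ.∸-monoʳ-≤ (suc n′) lb≥1)) n′<n
                m+w<M : m + w < M
                m+w<M = ℕ.<-≤-trans (ℕ.+-monoˡ-< w m<n) (ℕ.≤-pred N<1+M)
                a+lb≤N : a + lb ≤ N
                a+lb≤N = ℕ.≤-trans (ℕ.+-monoʳ-≤ a lb≤) (ℕ.≤-trans (ℕ.≤-reflexive a+n′≡n) (ℕ.m≤m+n n w))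
                N-a-lb : N ∸ (a + lb) ≡ m + w
                N-a-lb = +∸-+ a+n′≡n lb≤

            firstUnit-remaining : firstUnitSum l ≈ pathSumClosing (H l) l (suc n′)
            firstUnit-remaining = trans (firstUnitSum-byMove l) (sym (∑-cong-All Bs nonU closes))
              where
                closes : ∀ b → NonUStep w b →
                  𝟙 (len b ≤ᵇ suc n′) *R (F l *R pathSumAfter (move b) (H l) (suc n′ ∸ len b))
                  ≈ F l *R exitSum⁺ M (moveCharge (move b) + H l) (a + len b) N
                closes (step lb (up t) _) ((_ , lb≥1) , _) =
                  trans (continues (H l + t) lb lb≥1) (reflexive (≡.cong (λ k → F l *R exitSum⁺ M (suc k) (a + lb) N) (ℕ.+-comm (H l) t)))
                closes (step lb down _) ((_ , lb≥1) , down⇒w) with H l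
                ... | suc H′ = continues H′ lb lb≥1
                ... | zero   = trans (*-congˡ (trans (*-congˡ (∑-zero (words (suc n′ ∸ lb) (u ∷ Bs) (suc n′ ∸ lb)) (λ _ → refl))) (zeroʳ _)))
                                     (trans (zeroʳ _) (sym (trans (*-congˡ (exitSum⁺-exit-≢ M a+w≢N)) (zeroʳ _))))
                  where
                    a+w≢N : a + lb ≢ N
                    a+w≢N a+lb≡N = ℕ.<-irrefl (ℕ.+-cancelʳ-≡ w a n (≡.trans (≡.cong (a +_) (≡.sym (down⇒w ≡.refl))) a+lb≡N))
                                              (ℕ.≤-trans (s≤s (ℕ.m≤m+n a n′)) (ℕ.≤-reflexive (≡.trans (≡.sym (ℕ.+-suc a n′)) a+n′≡n)))

          firstBlockSum : ℕ → Carrier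
          firstBlockSum l = 𝟙 (l * suc r ≤ᵇ n) *R pathSumClosing (H l) l (n ∸ l * suc r)

          firstBlockSum≈firstUnitSum : ∀ l → firstBlockSum l ≈ firstUnitSum l
          firstBlockSum≈firstUnitSum l with l * suc r ℕ.≤? n
          ... | no  a≰n = trans (𝟙>-* (ℕ.≰⇒> a≰n) _) (sym (firstUnit-tooLong l (ℕ.≰⇒> a≰n)))
          ... | yes a≤n = trans (𝟙≤-* a≤n _) (byRemaining (n ∸ l * suc r) ≡.refl)
            where
              byRemaining : ∀ m → n ∸ l * suc r ≡ m → pathSumClosing (H l) l m ≈ firstUnitSum l
              byRemaining zero     n-a≡0  = sym (firstUnit-exact l (ℕ.≤-antisym a≤n (ℕ.m∸n≡0⇒m≤n n-a≡0)))
              byRemaining (suc n′) n-a≡1+ = sym (Remaining.firstUnit-remaining l n′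
                                                   (≡.trans (≡.cong (l * suc r +_) (≡.sym n-a≡1+)) (ℕ.m+[n∸m]≡n a≤n)))

          pathsAsUnits : pathSumFrom h 0 n ≈ exitSum (suc M) h N
          pathsAsUnits = begin
              pathSumFrom h 0 n
            ≈⟨ pathSumFrom-unfold (All-map proj₁ nonU) n n h 0 ℕ.≤-refl ⟩
              ∑< (suc n) firstBlockSum
            ≈⟨ sym (∑<-truncate (suc n) (suc B) firstBlockSum (s≤s n≤B) (λ l n<l _ → 𝟙>-* (ℕ.<-≤-trans n<l (ℕ.m≤m*n l (suc r))) _)) ⟩
              ∑< (suc B) firstBlockSum
            ≈⟨ ∑<-cong (suc B) (λ l _ → firstBlockSum≈firstUnitSum l) ⟩
              ∑[ l < suc B ] firstUnitSum l
            ≈⟨ sym (exitSum-firstUnit M h N) ⟩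
              exitSum (suc M) h N ∎

        pathSumFrom-as-exitSum : ∀ n → PathsAsUnits n
        pathSumFrom-as-exitSum = <-rec PathsAsUnits inductionStep
          where
            inductionStep : ∀ n → (∀ {n₀} → n₀ < n → PathsAsUnits n₀) → PathsAsUnits n
            inductionStep n IH h (suc M) n≤B N<1+M = FirstUnit.pathsAsUnits n IH n≤B h M N<1+M

  -- The general formula

  module GeneralFormula (f : ℕ → Carrier) (r s : ℕ) (Bs : List Step) where

    stepsCharge : List Step → ℕ
    stepsCharge bs = sum (map (moveCharge ∘ move) bs)

    stepsLength : List Step → ℕ
    stepsLength bs = sum (map len bs)

    unitsFit : ℕ → ℕ → ℕ → List Step → Carrier
    unitsFit m N i bs = 𝟙 (suc (i * s + stepsCharge bs) ≡ᵇ m) *R 𝟙 (i * suc r + stepsLength bs ≡ᵇ N)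

    introduceDegree : ∀ m N L bs (P : Carrier) →
      𝟙 (suc (L * s + stepsCharge bs) ≡ᵇ m) *R (𝟙 (L * suc r + stepsLength bs ≡ᵇ N) *R P)
      ≈ ∑[ i < suc N ] (𝟙 (L ≡ᵇ i) *R P) *R unitsFit m N i bs
    introduceDegree m N L bs P with L ℕ.≤? N
    ... | yes L≤N = sym (begin
        ∑[ i < suc N ] (𝟙 (L ≡ᵇ i) *R P) *R unitsFit m N i bs
      ≈⟨ ∑<-cong (suc N) (λ i _ → trans (*-congʳ (*-congʳ {P} (reflexive (≡.cong 𝟙 (≡ᵇ-sym L i))))) (*-assoc _ P (unitsFit m N i bs))) ⟩
        ∑[ i < suc N ] 𝟙 (0 + i ≡ᵇ L) *R (P *R unitsFit m N i bs)
      ≈⟨ ∑<-select (suc N) 0 L (λ i → P *R unitsFit m N i bs) (s≤s L≤N) ⟩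
        1# *R (P *R unitsFit m N L bs)
      ≈⟨ trans (*-identityˡ _) (trans (*-comm _ _) (*-assoc _ _ _)) ⟩
        𝟙 (suc (L * s + stepsCharge bs) ≡ᵇ m) *R (𝟙 (L * suc r + stepsLength bs ≡ᵇ N) *R P) ∎)
    ... | no L≰N = trans (*-congˡ (𝟙≢-* tooLong P)) (trans (zeroʳ _)
                     (sym (∑<-zero (suc N) (λ i i<1+N → trans (*-congʳ (𝟙≢-* (λ L≡i → L≰N (ℕ.≤-trans (ℕ.≤-reflexive L≡i) (ℕ.≤-pred i<1+N))) P))
                                                              (zeroˡ (unitsFit m N i bs))))))
      where
        tooLong : L * suc r + stepsLength bs ≢ N
        tooLong e = L≰N (ℕ.≤-trans (ℕ.m≤m*n L (suc r)) (ℕ.≤-trans (ℕ.m≤m+n _ _) (ℕ.≤-reflexive e)))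

    module Count (B : ℕ) where
      open Units f r s Bs B
      open PowerCoefficient (upTo (suc B)) (λ l → l) F F B (λ φ → reflexive (∑-upTo (suc B) _))

      sum-zip : ∀ k (d : Step → ℕ) ls bs → length ls ≡ length bs →
                sum (map (λ t → proj₁ t * k + d (proj₂ t)) (zip ls bs)) ≡ degree ls * k + sum (map d bs)
      sum-zip k d []       []       _    = ≡.refl
      sum-zip k d (l ∷ ls) (b ∷ bs) |ls| = ≡.trans (≡.cong (l * k + d b +_) (sum-zip k d ls bs (ℕ.suc-injective |ls|)))
                                                    (regroup l k (d b) (degree ls) (sum (map d bs)))
        where
          regroup : ∀ l k c L C → l * k + c + (L * k + C) ≡ (l + L) * k + (c + C)
          regroup = solve-∀

      unitWeight-zip : ∀ ls bs → length ls ≡ length bs → unitWeight (zip ls bs) ≡ Πl R (map F ls)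
      unitWeight-zip []       []       _    = ≡.refl
      unitWeight-zip (l ∷ ls) (b ∷ bs) |ls| = ≡.cong (F l *R_) (unitWeight-zip ls bs (ℕ.suc-injective |ls|))

      length-zip : ∀ (ls : List ℕ) (bs : List Step) → length ls ≡ length bs → length (zip ls bs) ≡ length ls
      length-zip []       []       _    = ≡.refl
      length-zip (l ∷ ls) (b ∷ bs) |ls| = ≡.cong suc (length-zip ls bs (ℕ.suc-injective |ls|))

      endsOneLower-count : ∀ m N → N ≤ B →
        ∑[ x ∈ units ^ m ] 𝟙 (endsOneLower x) *R weightOfLength N x ≈ ∑[ i < suc N ] (_^PS_ R F m) i *R ∑^ Bs m (unitsFit m N i)
      endsOneLower-count m N N≤B = begin
          ∑[ x ∈ units ^ m ] 𝟙 (endsOneLower x) *R weightOfLength N x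
        ≈⟨ ∑^-cartesianProduct Ls Bs m _ ⟩
          ∑[ ls ∈ Ls ^ m ] ∑[ bs ∈ Bs ^ m ] 𝟙 (endsOneLower (zip ls bs)) *R weightOfLength N (zip ls bs)
        ≈⟨ ∑^-cong Ls m (λ ls |ls| → ∑^-cong Bs m (λ bs |bs| →
             trans (reflexive (zip-terms ls bs (≡.trans |ls| (≡.sym |bs|)) |ls|)) (introduceDegree m N (degree ls) bs _))) ⟩
          ∑[ ls ∈ Ls ^ m ] ∑[ bs ∈ Bs ^ m ] ∑[ i < suc N ] (𝟙 (degree ls ≡ᵇ i) *R Πl R (map F ls)) *R unitsFit m N i bs
        ≈⟨ ∑^-cong Ls m (λ ls _ → trans (sym (∑<-∑^-comm Bs (suc N) m (λ i bs → coefficientTerm ls i *R unitsFit m N i bs)))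
                                        (∑<-cong (suc N) (λ i _ → sym (∑^-distribˡ Bs m (coefficientTerm ls i) (unitsFit m N i))))) ⟩
          ∑[ ls ∈ Ls ^ m ] ∑[ i < suc N ] (𝟙 (degree ls ≡ᵇ i) *R Πl R (map F ls)) *R ∑^ Bs m (unitsFit m N i)
        ≈⟨ sym (∑<-∑^-comm Ls (suc N) m (λ i ls → coefficientTerm ls i *R ∑^ Bs m (unitsFit m N i))) ⟩
          ∑[ i < suc N ] ∑[ ls ∈ Ls ^ m ] (𝟙 (degree ls ≡ᵇ i) *R Πl R (map F ls)) *R ∑^ Bs m (unitsFit m N i)
        ≈⟨ ∑<-cong (suc N) (λ i i<1+N → trans (sym (∑^-distribʳ Ls m (∑^ Bs m (unitsFit m N i)) (λ ls → coefficientTerm ls i)))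
                                               (*-congʳ (coefficient-power m i (ℕ.≤-trans (ℕ.≤-pred i<1+N) N≤B)))) ⟩
          ∑[ i < suc N ] (_^PS_ R F m) i *R ∑^ Bs m (unitsFit m N i) ∎
        where
          Ls : List ℕ
          Ls = upTo (suc B)
          coefficientTerm : List ℕ → ℕ → Carrier
          coefficientTerm ls i = 𝟙 (degree ls ≡ᵇ i) *R Πl R (map F ls)
          zip-terms : ∀ ls bs → length ls ≡ length bs → length ls ≡ m →
            𝟙 (endsOneLower (zip ls bs)) *R weightOfLength N (zip ls bs)
            ≡ 𝟙 (suc (degree ls * s + stepsCharge bs) ≡ᵇ m) *R (𝟙 (degree ls * suc r + stepsLength bs ≡ᵇ N) *R Πl R (map F ls))
          zip-terms ls bs same |ls| = ≡.cong₂ _*R_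
            (≡.cong 𝟙 (≡.cong₂ _≡ᵇ_ (≡.cong suc (sum-zip s (moveCharge ∘ move) ls bs same)) (≡.trans (length-zip ls bs same) |ls|)))
            (≡.cong₂ _*R_ (≡.cong (λ L → 𝟙 (L ≡ᵇ N)) (sum-zip (suc r) len ls bs same)) (unitWeight-zip ls bs same))

    module _ {w : ℕ} (w>0 : 0 < w) (nonU : All (NonUStep w) Bs) (oneDown : length (filterᵇ isDown Bs) ≡ 1)
             (inv : ℕ → Carrier) (isInv : IsInvNat R inv) (n : ℕ) where
      open Units f r s Bs (n + w)
      open Count (n + w)

      pathSum-formula : pathSum R f (u ∷ Bs) n ≈
        ∑[ m < n + w ] inv m *R (∑[ i < suc (n + w) ] (_^PS_ R F (suc m)) i *R ∑^ Bs (suc m) (unitsFit (suc m) (n + w) i))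
      pathSum-formula = begin
          pathSum R f (u ∷ Bs) n
        ≈⟨ ∑-filterᵇ (valid 0) (words n (u ∷ Bs) n) _ ⟩
          pathSumFrom 0 0 n
        ≈⟨ pathSumFrom-as-exitSum w>0 nonU oneDown n 0 (suc N) (ℕ.m≤m+n n w) ℕ.≤-refl ⟩
          exitSum (suc N) 0 N
        ≈⟨ trans (+-congʳ (zeroˡ _)) (+-identityˡ _) ⟩
          ∑[ m < N ] ∑[ x ∈ units ^ suc m ] 𝟙 (exits 0 x) *R weightOfLength N x
        ≈⟨ ∑<-cong N (λ m _ → byCycleLemma m) ⟩
          ∑[ m < N ] inv m *R (∑[ x ∈ units ^ suc m ] 𝟙 (endsOneLower x) *R weightOfLength N x)
        ≈⟨ ∑<-cong N (λ m _ → *-congˡ (endsOneLower-count (suc m) N ℕ.≤-refl)) ⟩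
          ∑[ m < N ] inv m *R (∑[ i < suc N ] (_^PS_ R F (suc m)) i *R ∑^ Bs (suc m) (unitsFit (suc m) N i)) ∎
        where
          N : ℕ
          N = n + w
          byCycleLemma : ∀ m → ∑[ x ∈ units ^ suc m ] 𝟙 (exits 0 x) *R weightOfLength N x
                               ≈ inv m *R (∑[ x ∈ units ^ suc m ] 𝟙 (endsOneLower x) *R weightOfLength N x)
          byCycleLemma m = sym (begin
              inv m *R (∑[ x ∈ units ^ suc m ] 𝟙 (endsOneLower x) *R weightOfLength N x)
            ≈⟨ *-congˡ (cycle-lemma unitCharge units (suc m) (weightOfLength N) (weightOfLength-rotate N)) ⟩
              inv m *R (fromℕ R (suc m) *R (∑[ x ∈ units ^ suc m ] 𝟙 (exits 0 x) *R weightOfLength N x))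
            ≈⟨ sym (*-assoc _ _ _) ⟩
              (inv m *R fromℕ R (suc m)) *R (∑[ x ∈ units ^ suc m ] 𝟙 (exits 0 x) *R weightOfLength N x)
            ≈⟨ trans (*-congʳ (trans (*-comm _ _) (isInv m))) (*-identityˡ _) ⟩
              ∑[ x ∈ units ^ suc m ] 𝟙 (exits 0 x) *R weightOfLength N x ∎)

  -- The two step sets

  module CaseA1 (f : ℕ → Carrier) (s : ℕ) (cnt : ℕ → ℕ) (n : ℕ) where

    W : Step
    W = step 1 down false

    V : ℕ → Step
    V t = step 1 (up t) false

    Vs : List Step
    Vs = concat (map (λ t → replicate (cnt t) (V t)) (upTo (suc n)))

    all-Vs : {P : Step → Set} → (∀ t → P (V t)) → All P Vs
    all-Vs p = All.concat⁺ (All.map⁺ (All.applyUpTo⁺₂ _ (suc n) (λ t → All.replicate⁺ (cnt t) (p t))))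

    open GeneralFormula f 0 s (W ∷ Vs)

    oneXV-generates : ∀ (φ : ℕ → Carrier) → ∑[ b ∈ W ∷ Vs ] 1# *R φ (moveCharge (move b)) ≈ ∑[ g < suc (suc n) ] oneXV R cnt g *R φ g
    oneXV-generates φ = +-congˡ (begin
        ∑[ b ∈ Vs ] 1# *R φ (moveCharge (move b))
      ≈⟨ ∑-concatMap (upTo (suc n)) (λ t → replicate (cnt t) (V t)) (λ b → 1# *R φ (moveCharge (move b))) ⟩
        ∑[ t ∈ upTo (suc n) ] ∑[ b ∈ replicate (cnt t) (V t) ] 1# *R φ (moveCharge (move b))
      ≈⟨ ∑-cong (upTo (suc n)) (λ t → trans (∑-replicate (cnt t) (V t) (λ b → 1# *R φ (moveCharge (move b)))) (*-congˡ (*-identityˡ _))) ⟩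
        ∑[ t ∈ upTo (suc n) ] fromℕ R (cnt t) *R φ (suc t)
      ≡⟨ ∑-upTo (suc n) _ ⟩
        ∑[ t < suc n ] fromℕ R (cnt t) *R φ (suc t) ∎)

    open PowerCoefficient (W ∷ Vs) (moveCharge ∘ move) (λ _ → 1#) (oneXV R cnt) (suc n) oneXV-generates

    G : ℕ → ℕ → Carrier
    G m = _^PS_ R (oneXV R cnt) m

    unitLengths : All (λ b → len b ≡ 1) (W ∷ Vs)
    unitLengths = ≡.refl ∷ all-Vs (λ _ → ≡.refl)

    stepsLength-units : ∀ bs → All (λ b → len b ≡ 1) bs → stepsLength bs ≡ length bs
    stepsLength-units []       []       = ≡.refl
    stepsLength-units (b ∷ bs) (e ∷ es) = ≡.cong₂ _+_ e (stepsLength-units bs es)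

    ∑-unitsFit-A1 : ∀ m i → m ≤ suc n →
      ∑^ (W ∷ Vs) m (unitsFit m (n + 1) i) ≈ 𝟙 (i + m ≡ᵇ n + 1) *R (𝟙 (suc (i * s) ≤ᵇ m) *R G m (m ∸ suc (i * s)))
    ∑-unitsFit-A1 m i m≤1+n = begin
        ∑^ (W ∷ Vs) m (unitsFit m (n + 1) i)
      ≈⟨ ∑^-cong-All (W ∷ Vs) unitLengths m split ⟩
        ∑[ bs ∈ (W ∷ Vs) ^ m ] (𝟙 (i + m ≡ᵇ n + 1) *R 𝟙 (suc (i * s) ≤ᵇ m)) *R (𝟙 (degree bs ≡ᵇ H) *R Πl R (map (λ _ → 1#) bs))
      ≈⟨ sym (∑^-distribˡ (W ∷ Vs) m _ _) ⟩
        (𝟙 (i + m ≡ᵇ n + 1) *R 𝟙 (suc (i * s) ≤ᵇ m)) *R (∑[ bs ∈ (W ∷ Vs) ^ m ] 𝟙 (degree bs ≡ᵇ H) *R Πl R (map (λ _ → 1#) bs))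
      ≈⟨ *-congˡ (coefficient-power m H (ℕ.≤-trans (ℕ.m∸n≤m m (suc (i * s))) m≤1+n)) ⟩
        (𝟙 (i + m ≡ᵇ n + 1) *R 𝟙 (suc (i * s) ≤ᵇ m)) *R G m H
      ≈⟨ *-assoc _ _ _ ⟩
        𝟙 (i + m ≡ᵇ n + 1) *R (𝟙 (suc (i * s) ≤ᵇ m) *R G m H) ∎
      where
        H : ℕ
        H = m ∸ suc (i * s)
        split : ∀ bs → length bs ≡ m → All (λ b → len b ≡ 1) bs →
                unitsFit m (n + 1) i bs ≈ (𝟙 (i + m ≡ᵇ n + 1) *R 𝟙 (suc (i * s) ≤ᵇ m)) *R (𝟙 (degree bs ≡ᵇ H) *R Πl R (map (λ _ → 1#) bs))
        split bs |bs| ones = begin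
            𝟙 (suc (i * s) + degree bs ≡ᵇ m) *R 𝟙 (i * 1 + stepsLength bs ≡ᵇ n + 1)
          ≡⟨ ≡.cong₂ (λ a b → 𝟙 a *R 𝟙 b) (+≡ᵇ-split (suc (i * s)) (degree bs) m)
                     (≡.cong (_≡ᵇ n + 1) (≡.cong₂ _+_ (ℕ.*-identityʳ i) (≡.trans (stepsLength-units bs ones) |bs|))) ⟩
            𝟙 ((suc (i * s) ≤ᵇ m) ∧ (degree bs ≡ᵇ H)) *R 𝟙 (i + m ≡ᵇ n + 1)
          ≈⟨ *-congʳ (𝟙-∧ (suc (i * s) ≤ᵇ m) _) ⟩
            (𝟙 (suc (i * s) ≤ᵇ m) *R 𝟙 (degree bs ≡ᵇ H)) *R 𝟙 (i + m ≡ᵇ n + 1)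
          ≈⟨ trans (*-comm _ _) (sym (*-assoc _ _ _)) ⟩
            (𝟙 (i + m ≡ᵇ n + 1) *R 𝟙 (suc (i * s) ≤ᵇ m)) *R 𝟙 (degree bs ≡ᵇ H)
          ≈⟨ *-congˡ (sym (trans (*-congˡ (Πl-ones bs)) (*-identityʳ _))) ⟩
            (𝟙 (i + m ≡ᵇ n + 1) *R 𝟙 (suc (i * s) ≤ᵇ m)) *R (𝟙 (degree bs ≡ᵇ H) *R Πl R (map (λ _ → 1#) bs)) ∎

    nonU : All (NonUStep 1) (W ∷ Vs)
    nonU = ((≡.refl , s≤s z≤n) , λ _ → ≡.refl) ∷ all-Vs (λ t → (≡.refl , s≤s z≤n) , λ ())

    oneDown : length (filterᵇ isDown (W ∷ Vs)) ≡ 1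
    oneDown = ≡.cong (suc ∘ length) (List.filter-none (T? ∘ isDown) (all-Vs (λ t ())))

    module _ (inv : ℕ → Carrier) (isInv : IsInvNat R inv) where

      F : PS R
      F = Fser R f

      lagrangeTerm : ℕ → ℕ → Carrier
      lagrangeTerm i m = inv m *R ((_^PS_ R F (suc m)) i *R (𝟙 (suc (i * s) ≤ᵇ suc m) *R G (suc m) (suc m ∸ suc (i * s))))

      rhsA1-term : ℕ → Carrier
      rhsA1-term i = inv (n ∸ i) *R ((_^PS_ R F (suc (n ∸ i))) i *R G (suc (n ∸ i)) (n ∸ suc s * i))

      lagrangeTerm≈rhsA1-term : ∀ i → i ≤ n / suc s → 𝟙 (suc i ≤ᵇ suc n) *R lagrangeTerm i (n ∸ i) ≈ rhsA1-term i
      lagrangeTerm≈rhsA1-term i i≤n/d = begin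
          𝟙 (suc i ≤ᵇ suc n) *R lagrangeTerm i (n ∸ i)
        ≈⟨ 𝟙≤-* (s≤s (ℕ.≤-trans (ℕ.m≤m+n i (i * s)) i+is≤n)) _ ⟩
          lagrangeTerm i (n ∸ i)
        ≈⟨ *-congˡ (*-congˡ (𝟙≤-* (s≤s (ℕ.m+n≤o⇒m≤o∸n (i * s) (ℕ.≤-trans (ℕ.≤-reflexive (ℕ.+-comm (i * s) i)) i+is≤n))) _)) ⟩
          inv (n ∸ i) *R ((_^PS_ R F (suc (n ∸ i))) i *R G (suc (n ∸ i)) (n ∸ i ∸ i * s))
        ≡⟨ ≡.cong (λ k → inv (n ∸ i) *R ((_^PS_ R F (suc (n ∸ i))) i *R G (suc (n ∸ i)) k))
                  (≡.trans (ℕ.∸-+-assoc n i (i * s)) (≡.cong (λ k → n ∸ (i + k)) (ℕ.*-comm i s))) ⟩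
          rhsA1-term i ∎
        where
          i+is≤n : i + i * s ≤ n
          i+is≤n = ℕ.≤-trans (ℕ.≤-reflexive (≡.cong (i +_) (ℕ.*-comm i s))) (≤/⇒*≤ i≤n/d)

      lagrangeTerm-vanish : ∀ i → n / suc s < i → 𝟙 (suc i ≤ᵇ suc n) *R lagrangeTerm i (n ∸ i) ≈ 0#
      lagrangeTerm-vanish i n/d<i with i ℕ.≤? n
      ... | no  i≰n = 𝟙>-* (s≤s (ℕ.≰⇒> i≰n)) _
      ... | yes i≤n = trans (*-congˡ (trans (*-congˡ (trans (*-congˡ (𝟙>-* (s≤s (ℕ.≰⇒> too-steep)) _)) (zeroʳ _)))
                                            (zeroʳ _)))
                            (zeroʳ _)
        where
          too-steep : ¬ (i * s ≤ n ∸ i)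
          too-steep is≤n-i = ℕ.<⇒≱ n/d<i (*≤⇒≤/ (ℕ.≤-trans (ℕ.≤-reflexive (≡.cong (i +_) (ℕ.*-comm s i)))
                               (ℕ.≤-trans (ℕ.+-monoʳ-≤ i is≤n-i) (ℕ.≤-reflexive (ℕ.m+[n∸m]≡n i≤n)))))

      pathSum-A1 : pathSum R f (alphabetA1 s cnt n) n ≈ rhsA1 R inv f s cnt n
      pathSum-A1 = begin
          pathSum R f (alphabetA1 s cnt n) n
        ≈⟨ pathSum-formula (s≤s z≤n) nonU oneDown inv isInv n ⟩
          ∑[ m < n + 1 ] inv m *R (∑[ i < suc (n + 1) ] (_^PS_ R F (suc m)) i *R ∑^ (W ∷ Vs) (suc m) (unitsFit (suc m) (n + 1) i))
        ≈⟨ ∑<-cong (n + 1) (λ m m<n+1 → trans (∑<-distribˡ (suc (n + 1)) (inv m) (countTerm m))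
                                              (∑<-cong (suc (n + 1)) (λ i _ → solveLength m i m<n+1))) ⟩
          ∑[ m < n + 1 ] ∑[ i < suc (n + 1) ] 𝟙 (suc i + m ≡ᵇ suc n) *R lagrangeTerm i m
        ≈⟨ ∑<-comm (n + 1) (suc (n + 1)) (λ m i → 𝟙 (suc i + m ≡ᵇ suc n) *R lagrangeTerm i m) ⟩
          ∑[ i < suc (n + 1) ] ∑[ m < n + 1 ] 𝟙 (suc i + m ≡ᵇ suc n) *R lagrangeTerm i m
        ≈⟨ ∑<-cong (suc (n + 1)) (λ i _ → ∑<-select (n + 1) (suc i) (suc n) (lagrangeTerm i) (1+n<1+i+[n+1] i)) ⟩
          ∑[ i < suc (n + 1) ] 𝟙 (suc i ≤ᵇ suc n) *R lagrangeTerm i (n ∸ i)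
        ≈⟨ ∑<-truncate (suc (n / suc s)) (suc (n + 1)) selected n/d<n+2 (λ i n/d<i _ → lagrangeTerm-vanish i n/d<i) ⟩
          ∑[ i < suc (n / suc s) ] 𝟙 (suc i ≤ᵇ suc n) *R lagrangeTerm i (n ∸ i)
        ≈⟨ ∑<-cong (suc (n / suc s)) (λ i i<1+n/d → lagrangeTerm≈rhsA1-term i (ℕ.≤-pred i<1+n/d)) ⟩
          ∑[ i < suc (n / suc s) ] rhsA1-term i
        ≡⟨ ≡.sym (∑-upTo (suc (n / suc s)) rhsA1-term) ⟩
          rhsA1 R inv f s cnt n ∎
        where
          countTerm : ℕ → ℕ → Carrier
          countTerm m i = (_^PS_ R F (suc m)) i *R ∑^ (W ∷ Vs) (suc m) (unitsFit (suc m) (n + 1) i)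
          selected : ℕ → Carrier
          selected i = 𝟙 (suc i ≤ᵇ suc n) *R lagrangeTerm i (n ∸ i)
          1+n<1+i+[n+1] : ∀ i → suc n < suc i + (n + 1)
          1+n<1+i+[n+1] i = s≤s (ℕ.≤-trans (ℕ.≤-reflexive (≡.sym (ℕ.+-comm n 1))) (ℕ.m≤n+m (n + 1) i))
          n/d<n+2 : suc (n / suc s) ≤ suc (n + 1)
          n/d<n+2 = s≤s (ℕ.≤-trans (DivMod.m/n≤m n (suc s)) (ℕ.m≤m+n n 1))
          solveLength : ∀ m i → m < n + 1 →
            inv m *R ((_^PS_ R F (suc m)) i *R ∑^ (W ∷ Vs) (suc m) (unitsFit (suc m) (n + 1) i)) ≈ 𝟙 (suc i + m ≡ᵇ suc n) *R lagrangeTerm i m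
          solveLength m i m<n+1 = begin
              inv m *R ((_^PS_ R F (suc m)) i *R ∑^ (W ∷ Vs) (suc m) (unitsFit (suc m) (n + 1) i))
            ≈⟨ *-congˡ (*-congˡ (∑-unitsFit-A1 (suc m) i (ℕ.≤-trans m<n+1 (ℕ.≤-reflexive (ℕ.+-comm n 1))))) ⟩
              inv m *R ((_^PS_ R F (suc m)) i *R (𝟙 (i + suc m ≡ᵇ n + 1) *R (𝟙 (suc (i * s) ≤ᵇ suc m) *R G (suc m) (suc m ∸ suc (i * s)))))
            ≈⟨ trans (*-congˡ (x∙yz≈y∙xz _ _ _)) (x∙yz≈y∙xz _ _ _) ⟩
              𝟙 (i + suc m ≡ᵇ n + 1) *R lagrangeTerm i m
            ≡⟨ ≡.cong (λ b → 𝟙 b *R lagrangeTerm i m) (≡.cong₂ _≡ᵇ_ (ℕ.+-suc i m) (ℕ.+-comm n 1)) ⟩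
              𝟙 (suc i + m ≡ᵇ suc n) *R lagrangeTerm i m ∎

  module CaseA2 (f : ℕ → Carrier) (r₁ s₁ r₂ s₂ w n : ℕ) where

    V W : Step
    V = step (suc r₂) (up s₂) false
    W = step (suc w) down false

    N : ℕ
    N = n + suc w

    open GeneralFormula f r₁ s₁ (V ∷ W ∷ [])

    onePlusX-generates : ∀ k (φ : ℕ → Carrier) →
      ∑[ b ∈ V ∷ W ∷ [] ] 1# *R φ (upCount (move b)) ≈ ∑[ g < suc (suc k) ] onePlusX g *R φ g
    onePlusX-generates k φ = trans (trans (+-congˡ (+-identityʳ _)) (+-comm _ _))
                                   (+-congˡ (sym (trans (+-congˡ (∑<-zero k (λ g _ → zeroˡ _))) (+-identityʳ _))))

    open PowerCoefficient (V ∷ W ∷ []) (upCount ∘ move) (λ _ → 1#) onePlusX (suc (n + w)) (onePlusX-generates (n + w))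

    IsVW : Step → Set
    IsVW b = b ≡ V ⊎ b ≡ W

    downs : List Step → ℕ
    downs bs = sum (map (downCount ∘ move) bs)

    degree+downs : ∀ bs → All IsVW bs → degree bs + downs bs ≡ length bs
    degree+downs []       []                  = ≡.refl
    degree+downs (_ ∷ bs) (inj₁ ≡.refl ∷ vws) = ≡.cong suc (degree+downs bs vws)
    degree+downs (_ ∷ bs) (inj₂ ≡.refl ∷ vws) = ≡.trans (ℕ.+-suc (degree bs) (downs bs)) (≡.cong suc (degree+downs bs vws))

    stepsCharge-VW : ∀ bs → All IsVW bs → stepsCharge bs ≡ degree bs * suc s₂
    stepsCharge-VW []       []                  = ≡.refl
    stepsCharge-VW (_ ∷ bs) (inj₁ ≡.refl ∷ vws) = ≡.cong (suc s₂ +_) (stepsCharge-VW bs vws)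
    stepsCharge-VW (_ ∷ bs) (inj₂ ≡.refl ∷ vws) = stepsCharge-VW bs vws

    stepsLength-VW : ∀ bs → All IsVW bs → stepsLength bs ≡ degree bs * suc r₂ + downs bs * suc w
    stepsLength-VW []       []                  = ≡.refl
    stepsLength-VW (_ ∷ bs) (inj₁ ≡.refl ∷ vws) = ≡.trans (≡.cong (suc r₂ +_) (stepsLength-VW bs vws)) (≡.sym (ℕ.+-assoc (suc r₂) _ _))
    stepsLength-VW (_ ∷ bs) (inj₂ ≡.refl ∷ vws) =
      ≡.trans (≡.cong (suc w +_) (stepsLength-VW bs vws)) (shuffle (degree bs * suc r₂) (suc w) (downs bs * suc w))
      where
        shuffle : ∀ a b c → b + (a + c) ≡ a + (b + c)
        shuffle = solve-∀

    unitsFitVs : ℕ → ℕ → ℕ → Carrier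
    unitsFitVs m i j = 𝟙 (suc (i * s₁ + j * suc s₂) ≡ᵇ m) *R 𝟙 (i * suc r₁ + (j * suc r₂ + (m ∸ j) * suc w) ≡ᵇ N)

    ∑-unitsFit-A2 : ∀ m i → m ≤ N → ∑^ (V ∷ W ∷ []) m (unitsFit m N i) ≈ ∑[ j < suc N ] fromℕ R (m C j) *R unitsFitVs m i j
    ∑-unitsFit-A2 m i m≤N = begin
        ∑^ (V ∷ W ∷ []) m (unitsFit m N i)
      ≈⟨ ∑^-cong-All (V ∷ W ∷ []) (inj₁ ≡.refl ∷ inj₂ ≡.refl ∷ []) m bySelectingDegree ⟩
        ∑[ bs ∈ (V ∷ W ∷ []) ^ m ] ∑[ j < suc N ] (𝟙 (degree bs ≡ᵇ j) *R Πl R (map (λ _ → 1#) bs)) *R unitsFitVs m i j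
      ≈⟨ sym (∑<-∑^-comm (V ∷ W ∷ []) (suc N) m (λ j bs → unitsMinus1 bs j *R unitsFitVs m i j)) ⟩
        ∑[ j < suc N ] ∑[ bs ∈ (V ∷ W ∷ []) ^ m ] (𝟙 (degree bs ≡ᵇ j) *R Πl R (map (λ _ → 1#) bs)) *R unitsFitVs m i j
      ≈⟨ ∑<-cong (suc N) (λ j j<1+N → trans (sym (∑^-distribʳ (V ∷ W ∷ []) m (unitsFitVs m i j) (λ bs → unitsMinus1 bs j)))
                                             (*-congʳ (trans (coefficient-power m j (ℕ.≤-trans (ℕ.≤-pred j<1+N) (ℕ.≤-reflexive (ℕ.+-suc n w))))
                                                             (onePlusX-power m j)))) ⟩
        ∑[ j < suc N ] fromℕ R (m C j) *R unitsFitVs m i j ∎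
      where
        unitsMinus1 : List Step → ℕ → Carrier
        unitsMinus1 bs j = 𝟙 (degree bs ≡ᵇ j) *R Πl R (map (λ _ → 1#) bs)
        bySelectingDegree : ∀ bs → length bs ≡ m → All IsVW bs →
          unitsFit m N i bs ≈ ∑[ j < suc N ] (𝟙 (degree bs ≡ᵇ j) *R Πl R (map (λ _ → 1#) bs)) *R unitsFitVs m i j
        bySelectingDegree bs |bs| vws = sym (begin
            ∑[ j < suc N ] (𝟙 (degree bs ≡ᵇ j) *R Πl R (map (λ _ → 1#) bs)) *R unitsFitVs m i j
          ≈⟨ ∑<-cong (suc N) (λ j _ → *-congʳ {unitsFitVs m i j}
               (trans (*-congˡ (Πl-ones bs)) (trans (*-identityʳ _) (reflexive (≡.cong 𝟙 (≡ᵇ-sym (degree bs) j)))))) ⟩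
            ∑[ j < suc N ] 𝟙 (0 + j ≡ᵇ degree bs) *R unitsFitVs m i j
          ≈⟨ ∑<-select (suc N) 0 (degree bs) (unitsFitVs m i) (s≤s degree≤N) ⟩
            1# *R unitsFitVs m i (degree bs)
          ≈⟨ *-identityˡ _ ⟩
            unitsFitVs m i (degree bs)
          ≡⟨ ≡.cong₂ (λ c l → 𝟙 (suc (i * s₁ + c) ≡ᵇ m) *R 𝟙 (i * suc r₁ + l ≡ᵇ N))
                     (≡.sym (stepsCharge-VW bs vws))
                     (≡.sym (≡.trans (stepsLength-VW bs vws) (≡.cong (λ k → degree bs * suc r₂ + k * suc w) downs≡))) ⟩
            unitsFit m N i bs ∎)
          where
            downs≡ : downs bs ≡ m ∸ degree bs
            downs≡ = ≡.trans (≡.sym (ℕ.m+n∸m≡n (degree bs) (downs bs))) (≡.cong (_∸ degree bs) (≡.trans (degree+downs bs vws) |bs|))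
            degree≤N : degree bs ≤ N
            degree≤N = ℕ.≤-trans (ℕ.m≤m+n (degree bs) (downs bs)) (ℕ.≤-trans (ℕ.≤-reflexive (≡.trans (degree+downs bs vws) |bs|)) m≤N)

    nonU : All (NonUStep (suc w)) (V ∷ W ∷ [])
    nonU = ((≡.refl , s≤s z≤n) , λ ()) ∷ ((≡.refl , s≤s z≤n) , λ _ → ≡.refl) ∷ []

    pathLength : ℕ → ℕ → ℕ
    pathLength i j = (suc w * s₁ + suc r₁) * i + (suc w * s₂ + suc r₂) * j

    unitsMinus1 : ℕ → ℕ → ℕ
    unitsMinus1 i j = i * s₁ + j * suc s₂

    unitsFitVs-pathLength : ∀ i j → (i * suc r₁ + (j * suc r₂ + (suc (unitsMinus1 i j) ∸ j) * suc w) ≡ᵇ N) ≡ (pathLength i j ≡ᵇ n)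
    unitsFitVs-pathLength i j = ≡.trans (≡.cong (_≡ᵇ N) total) (+-cancelʳ-≡ᵇ (pathLength i j) n (suc w))
      where
        downs-count : suc (unitsMinus1 i j) ∸ j ≡ suc (i * s₁ + j * s₂)
        downs-count = ≡.trans (≡.cong (_∸ j) (regroup i s₁ j s₂)) (ℕ.m+n∸m≡n j _)
          where
            regroup : ∀ i s₁ j s₂ → suc (i * s₁ + j * suc s₂) ≡ j + suc (i * s₁ + j * s₂)
            regroup = solve-∀
        total : i * suc r₁ + (j * suc r₂ + (suc (unitsMinus1 i j) ∸ j) * suc w) ≡ pathLength i j + suc w
        total = ≡.trans (≡.cong (λ k → i * suc r₁ + (j * suc r₂ + k * suc w)) downs-count) (regroup i r₁ j r₂ s₁ s₂ w)
          where
            regroup : ∀ i r₁ j r₂ s₁ s₂ w → i * suc r₁ + (j * suc r₂ + suc (i * s₁ + j * s₂) * suc w)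
                                            ≡ (suc w * s₁ + suc r₁) * i + (suc w * s₂ + suc r₂) * j + suc w
            regroup = solve-∀

    unitsMinus1≤pathLength : ∀ i j → unitsMinus1 i j ≤ pathLength i j
    unitsMinus1≤pathLength i j = ℕ.+-mono-≤ (ℕ.≤-trans (ℕ.m≤m+n (i * s₁) _) (ℕ.≤-reflexive (regroup₁ i s₁ w r₁)))
                                (ℕ.≤-trans (ℕ.m≤m+n (j * suc s₂) _) (ℕ.≤-reflexive (regroup₂ j s₂ w r₂)))
      where
        regroup₁ : ∀ i s w r → i * s + (w * s + suc r) * i ≡ (suc w * s + suc r) * i
        regroup₁ = solve-∀
        regroup₂ : ∀ j s w r → j * suc s + (w * s + r) * j ≡ (suc w * s + suc r) * j
        regroup₂ = solve-∀

    i≤pathLength : ∀ i j → i ≤ pathLength i j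
    i≤pathLength i j = ℕ.≤-trans (ℕ.≤-trans (ℕ.m≤m+n i _) (ℕ.≤-reflexive (regroup i s₁ w r₁))) (ℕ.m≤m+n _ _)
      where
        regroup : ∀ i s w r → i + (w * s + s + r) * i ≡ (suc w * s + suc r) * i
        regroup = solve-∀

    j≤pathLength : ∀ i j → j ≤ pathLength i j
    j≤pathLength i j = ℕ.≤-trans (ℕ.≤-trans (ℕ.m≤m+n j _) (ℕ.≤-reflexive (regroup j s₂ w r₂))) (ℕ.m≤n+m _ _)
      where
        regroup : ∀ j s w r → j + (w * s + s + r) * j ≡ (suc w * s + suc r) * j
        regroup = solve-∀

    module _ (inv : ℕ → Carrier) (isInv : IsInvNat R inv) where

      F : PS R
      F = Fser R f

      rhsA2-term : ℕ → ℕ → Carrier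
      rhsA2-term i j = inv (s₁ * i + suc s₂ * j) *R ((_^PS_ R F (s₁ * i + suc s₂ * j + 1)) i *R fromℕ R ((s₁ * i + suc s₂ * j + 1) C j))

      lagrangeTerm : ℕ → ℕ → ℕ → Carrier
      lagrangeTerm m i j = inv m *R ((_^PS_ R F (suc m)) i *R (fromℕ R (suc m C j) *R unitsFitVs (suc m) i j))

      lagrangeTerm-select : ∀ i j → ∑[ m < N ] lagrangeTerm m i j ≈ 𝟙 (pathLength i j ≡ᵇ n) *R rhsA2-term i j
      lagrangeTerm-select i j with unitsMinus1 i j ℕ.<? N
      ... | yes unitsMinus1<N = begin
          ∑[ m < N ] lagrangeTerm m i j
        ≈⟨ ∑<-cong N (λ m _ → trans (reorder m) (*-congʳ (reflexive (≡.cong 𝟙 (≡ᵇ-sym (unitsMinus1 i j) m))))) ⟩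
          ∑[ m < N ] 𝟙 (0 + m ≡ᵇ unitsMinus1 i j) *R termAt m
        ≈⟨ trans (∑<-select N 0 (unitsMinus1 i j) termAt unitsMinus1<N) (*-identityˡ _) ⟩
          termAt (unitsMinus1 i j)
        ≡⟨ ≡.cong (λ b → inv (unitsMinus1 i j) *R ((_^PS_ R F (suc (unitsMinus1 i j))) i *R (fromℕ R (suc (unitsMinus1 i j) C j) *R 𝟙 b)))
                  (unitsFitVs-pathLength i j) ⟩
          inv (unitsMinus1 i j) *R ((_^PS_ R F (suc (unitsMinus1 i j))) i *R (fromℕ R (suc (unitsMinus1 i j) C j) *R 𝟙 (pathLength i j ≡ᵇ n)))
        ≈⟨ trans (*-congˡ (trans (*-congˡ (*-comm _ _)) (x∙yz≈y∙xz _ _ _))) (x∙yz≈y∙xz _ _ _) ⟩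
          𝟙 (pathLength i j ≡ᵇ n) *R (inv (unitsMinus1 i j) *R ((_^PS_ R F (suc (unitsMinus1 i j))) i *R fromℕ R (suc (unitsMinus1 i j) C j)))
        ≡⟨ ≡.cong (λ k → 𝟙 (pathLength i j ≡ᵇ n) *R (inv k *R ((_^PS_ R F (suc k)) i *R fromℕ R (suc k C j)))) orient ⟩
          𝟙 (pathLength i j ≡ᵇ n) *R (inv (s₁ * i + suc s₂ * j) *R ((_^PS_ R F (suc (s₁ * i + suc s₂ * j))) i *R fromℕ R (suc (s₁ * i + suc s₂ * j) C j)))
        ≡⟨ ≡.cong (λ k → 𝟙 (pathLength i j ≡ᵇ n) *R (inv (s₁ * i + suc s₂ * j) *R ((_^PS_ R F k) i *R fromℕ R (k C j))))
                  (ℕ.+-comm 1 (s₁ * i + suc s₂ * j)) ⟩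
          𝟙 (pathLength i j ≡ᵇ n) *R rhsA2-term i j ∎
        where
          termAt : ℕ → Carrier
          termAt m = inv m *R ((_^PS_ R F (suc m)) i *R (fromℕ R (suc m C j) *R 𝟙 (i * suc r₁ + (j * suc r₂ + (suc m ∸ j) * suc w) ≡ᵇ N)))
          reorder : ∀ m → lagrangeTerm m i j ≈ 𝟙 (unitsMinus1 i j ≡ᵇ m) *R termAt m
          reorder m = trans (*-congˡ (trans (*-congˡ (x∙yz≈y∙xz _ _ _)) (x∙yz≈y∙xz _ _ _))) (x∙yz≈y∙xz _ _ _)
          orient : unitsMinus1 i j ≡ s₁ * i + suc s₂ * j
          orient = ≡.cong₂ _+_ (ℕ.*-comm i s₁) (ℕ.*-comm j (suc s₂))
      ... | no unitsMinus1≮N = trans (∑<-zero N noTerm) (sym (𝟙-¬T-* tooLong (rhsA2-term i j)))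
        where
          noTerm : ∀ m → m < N → lagrangeTerm m i j ≈ 0#
          noTerm m m<N = trans (*-congˡ (trans (*-congˡ (trans (*-congˡ (𝟙≢-* (λ e → unitsMinus1≮N (ℕ.≤-<-trans (ℕ.≤-reflexive e) m<N)) _))
                                                                (zeroʳ _)))
                                               (zeroʳ _)))
                               (zeroʳ _)
          tooLong : ¬ T (pathLength i j ≡ᵇ n)
          tooLong t = unitsMinus1≮N (ℕ.≤-<-trans (ℕ.≤-trans (unitsMinus1≤pathLength i j) (ℕ.≤-reflexive (ℕ.≡ᵇ⇒≡ _ n t)))
                                                 (ℕ.m<m+n n (s≤s z≤n)))

      rhsA2-as-sum : rhsA2 R inv f (suc r₁) s₁ (suc r₂) s₂ (suc w) n ≈ ∑[ i < suc n ] ∑[ j < suc n ] 𝟙 (pathLength i j ≡ᵇ n) *R rhsA2-term i j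
      rhsA2-as-sum = begin
          rhsA2 R inv f (suc r₁) s₁ (suc r₂) s₂ (suc w) n
        ≈⟨ Σl-concatMap (upTo (suc n)) (λ i → concatMap (cell i) (upTo (suc n))) ⟩
          ∑[ i ∈ upTo (suc n) ] Σl R (concatMap (cell i) (upTo (suc n)))
        ≈⟨ ∑-cong (upTo (suc n)) (λ i → trans (Σl-concatMap (upTo (suc n)) (cell i))
                                             (trans (∑-cong (upTo (suc n)) (λ j → Σl-if (pathLength i j ≡ᵇ n) (rhsA2-term i j)))
                                                    (reflexive (∑-upTo (suc n) _)))) ⟩
          ∑[ i ∈ upTo (suc n) ] ∑[ j < suc n ] 𝟙 (pathLength i j ≡ᵇ n) *R rhsA2-term i j
        ≡⟨ ∑-upTo (suc n) _ ⟩
          ∑[ i < suc n ] ∑[ j < suc n ] 𝟙 (pathLength i j ≡ᵇ n) *R rhsA2-term i j ∎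
        where
          cell : ℕ → ℕ → List Carrier
          cell i j = if pathLength i j ≡ᵇ n then rhsA2-term i j ∷ [] else []

      pathSum-A2 : pathSum R f (alphabetA2 (suc r₁) s₁ (suc r₂) s₂ (suc w)) n ≈ rhsA2 R inv f (suc r₁) s₁ (suc r₂) s₂ (suc w) n
      pathSum-A2 = begin
          pathSum R f (alphabetA2 (suc r₁) s₁ (suc r₂) s₂ (suc w)) n
        ≈⟨ pathSum-formula (s≤s z≤n) nonU ≡.refl inv isInv n ⟩
          ∑[ m < N ] inv m *R (∑[ i < suc N ] (_^PS_ R F (suc m)) i *R ∑^ (V ∷ W ∷ []) (suc m) (unitsFit (suc m) N i))
        ≈⟨ ∑<-cong N expand ⟩
          ∑[ m < N ] ∑[ i < suc N ] ∑[ j < suc N ] lagrangeTerm m i j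
        ≈⟨ ∑<-comm N (suc N) (λ m i → ∑[ j < suc N ] lagrangeTerm m i j) ⟩
          ∑[ i < suc N ] ∑[ m < N ] ∑[ j < suc N ] lagrangeTerm m i j
        ≈⟨ ∑<-cong (suc N) (λ i _ → ∑<-comm N (suc N) (λ m j → lagrangeTerm m i j)) ⟩
          ∑[ i < suc N ] ∑[ j < suc N ] ∑[ m < N ] lagrangeTerm m i j
        ≈⟨ ∑<-cong (suc N) (λ i _ → ∑<-cong (suc N) (λ j _ → lagrangeTerm-select i j)) ⟩
          ∑[ i < suc N ] ∑[ j < suc N ] 𝟙 (pathLength i j ≡ᵇ n) *R rhsA2-term i j
        ≈⟨ ∑<-truncate (suc n) (suc N) (λ i → ∑< (suc N) (selected i)) n≤N (λ i n<i _ → ∑<-zero (suc N) (λ j _ → 𝟙≢-* (λ e → ℕ.<⇒≱ n<i (ℕ.≤-trans (i≤pathLength i j) (ℕ.≤-reflexive e))) (rhsA2-term i j))) ⟩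
          ∑[ i < suc n ] ∑[ j < suc N ] 𝟙 (pathLength i j ≡ᵇ n) *R rhsA2-term i j
        ≈⟨ ∑<-cong (suc n) (λ i _ → ∑<-truncate (suc n) (suc N) (selected i) n≤N (λ j n<j _ → 𝟙≢-* (λ e → ℕ.<⇒≱ n<j (ℕ.≤-trans (j≤pathLength i j) (ℕ.≤-reflexive e))) (rhsA2-term i j))) ⟩
          ∑[ i < suc n ] ∑[ j < suc n ] 𝟙 (pathLength i j ≡ᵇ n) *R rhsA2-term i j
        ≈⟨ sym rhsA2-as-sum ⟩
          rhsA2 R inv f (suc r₁) s₁ (suc r₂) s₂ (suc w) n ∎
        where
          selected : ℕ → ℕ → Carrier
          selected i j = 𝟙 (pathLength i j ≡ᵇ n) *R rhsA2-term i j
          binomialTerm : ℕ → ℕ → ℕ → Carrier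
          binomialTerm m i j = fromℕ R (suc m C j) *R unitsFitVs (suc m) i j
          expand : ∀ m → m < N → inv m *R (∑[ i < suc N ] (_^PS_ R F (suc m)) i *R ∑^ (V ∷ W ∷ []) (suc m) (unitsFit (suc m) N i))
                                 ≈ ∑[ i < suc N ] ∑[ j < suc N ] lagrangeTerm m i j
          expand m m<N = begin
              inv m *R (∑[ i < suc N ] (_^PS_ R F (suc m)) i *R ∑^ (V ∷ W ∷ []) (suc m) (unitsFit (suc m) N i))
            ≈⟨ *-congˡ (∑<-cong (suc N) (λ i _ → *-congˡ {(_^PS_ R F (suc m)) i} (∑-unitsFit-A2 (suc m) i m<N))) ⟩
              inv m *R (∑[ i < suc N ] (_^PS_ R F (suc m)) i *R ∑< (suc N) (binomialTerm m i))
            ≈⟨ ∑<-distribˡ (suc N) (inv m) (λ i → (_^PS_ R F (suc m)) i *R ∑< (suc N) (binomialTerm m i)) ⟩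
              ∑[ i < suc N ] inv m *R ((_^PS_ R F (suc m)) i *R ∑< (suc N) (binomialTerm m i))
            ≈⟨ ∑<-cong (suc N) (λ i _ → trans (*-congˡ (∑<-distribˡ (suc N) ((_^PS_ R F (suc m)) i) (binomialTerm m i)))
                                               (∑<-distribˡ (suc N) (inv m) (λ j → (_^PS_ R F (suc m)) i *R binomialTerm m i j))) ⟩
              ∑[ i < suc N ] ∑[ j < suc N ] lagrangeTerm m i j ∎
          n≤N : suc n ≤ suc N
          n≤N = s≤s (ℕ.m≤m+n n (suc w))

theorem2p3 : ∀ {c ℓ : Level} (R : CommutativeRing c ℓ)
    → (inv : ℕ → CommutativeRing.Carrier R) → IsInvNat R inv
    → (f : ℕ → CommutativeRing.Carrier R)
    → ((s : ℕ) (cnt : ℕ → ℕ) (n : ℕ)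
         → CommutativeRing._≈_ R (pathSum R f (alphabetA1 s cnt n) n) (rhsA1 R inv f s cnt n))
    × ((r₁ s₁ r₂ s₂ w : ℕ) (n : ℕ)
         → CommutativeRing._≈_ R (pathSum R f (alphabetA2 (suc r₁) s₁ (suc r₂) s₂ (suc w)) n)
                                 (rhsA2 R inv f (suc r₁) s₁ (suc r₂) s₂ (suc w) n))
theorem2p3 R inv isInv f =
  (λ s cnt n → CaseA1.pathSum-A1 R f s cnt n inv isInv) ,
  (λ r₁ s₁ r₂ s₂ w n → CaseA2.pathSum-A2 R f r₁ s₁ r₂ s₂ w n inv isInv)
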